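{- Let $q$ be an odd prime power and $n \geq 1$. Let $C(X) = X^n + \sum_{i=0}^{n-1} c_i X^i$ be a monic irreducible polynomial of degree $n$ over $\mathbb{F}_q$, and set $c_n = 1$ and $c_s = 0$ for $s > n$. Then there is a polynomial $A(X) \in \mathbb{F}_q[X]$ of degree $n$ such that $$C(X) \cdot (-1)^n C(-X) = A(X^2),$$ namely $$A(X) = (-1)^n \sum_{j=0}^{n} \sum_{u=0}^{2j} (-1)^u c_u c_{2j-u} X^j.$$ Furthermore: (a) $A(X)$ is irreducible over $\mathbb{F}_q$ if and only if there is at least one odd $i$ with $1 \leq i \leq n$ and $c_i \neq 0$. (b) If $A(X) \neq X$ is irreducible, then $A(X)$ is the minimal polynomial over $\mathbb{F}_q$ of $\beta^2$, where $\beta \in \mathbb{F}_{q^n}$ is a zero of $C(X)$; in this case $\mathrm{ord}(A(X)) = \mathrm{ord}(C(X)) / \gcd(2, \mathrm{ord}(C(X)))$.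
   Context: For an irreducible polynomial $F(X) \neq X$ over $\mathbb{F}_q$ of degree $n$, its order $\mathrm{ord}(F(X))$ is the multiplicative order of any of its zeros in $\mathbb{F}_{q^n}^*$. -}

module Defs where

open import Level using (0ℓ)
open import Algebra.Bundles using (CommutativeRing)
open import Data.Nat as ℕ using (ℕ; zero; suc; _≤_; _%_; _/_; NonZero; ≢-nonZero)
open import Data.Nat.GCD using (gcd; gcd[m,n]≡0⇒m≡0)
open import Data.Nat.Primality using (Prime)
open import Data.Fin using (Fin)
open import Data.List using (List; []; _∷_; map; upTo)
open import Data.Product using (Σ; ∃; _×_; _,_)
open import Relation.Nullary using (¬_)
open import Relation.Binary.PropositionalEquality using (_≡_)
open import Data.Sum using (_⊎_)
import Data.Empty

OddPrimePower : ℕ → Set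
OddPrimePower q = (∃ λ p → ∃ λ k → Prime p × q ≡ p ℕ.^ suc k) × q % 2 ≡ 1

record FiniteField (q : ℕ) : Set₁ where
  field
    commRing : CommutativeRing 0ℓ 0ℓ
  open CommutativeRing commRing public hiding (zero)
  field
    1≉0       : ¬ (1# ≈ 0#)
    inverse   : ∀ x → ¬ (x ≈ 0#) → ∃ λ y → (x * y) ≈ 1#
    enum      : Fin q → Carrier
    enum-inj  : ∀ i j → enum i ≈ enum j → i ≡ j
    enum-surj : ∀ x → ∃ λ i → enum i ≈ x

record RingHom {q r : ℕ} (F : FiniteField q) (E : FiniteField r) : Set where
  private
    module F = FiniteField F
    module E = FiniteField E
  field
    ⟦_⟧    : F.Carrier → E.Carrier
    cong   : ∀ {x y} → x F.≈ y → ⟦ x ⟧ E.≈ ⟦ y ⟧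
    +-hom  : ∀ x y → ⟦ x F.+ y ⟧ E.≈ (⟦ x ⟧ E.+ ⟦ y ⟧)
    *-hom  : ∀ x y → ⟦ x F.* y ⟧ E.≈ (⟦ x ⟧ E.* ⟦ y ⟧)
    1-hom  : ⟦ F.1# ⟧ E.≈ E.1#

-- Polynomials over a field, as coefficient lists (constant term first);
-- equality is coefficientwise ≈ (trailing zeros irrelevant).

module Poly {q : ℕ} (F : FiniteField q) where
  open FiniteField F

  Pol : Set
  Pol = List Carrier

  coeff : Pol → ℕ → Carrier
  coeff []      _       = 0#
  coeff (a ∷ p) zero    = a
  coeff (a ∷ p) (suc i) = coeff p i

  infix 4 _≈ₚ_
  _≈ₚ_ : Pol → Pol → Set
  p ≈ₚ r = ∀ i → coeff p i ≈ coeff r i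

  infixl 6 _+ₚ_
  _+ₚ_ : Pol → Pol → Pol
  []      +ₚ r       = r
  (a ∷ p) +ₚ []      = a ∷ p
  (a ∷ p) +ₚ (b ∷ r) = (a + b) ∷ (p +ₚ r)

  scale : Carrier → Pol → Pol
  scale c = map (c *_)

  infixl 7 _*ₚ_
  _*ₚ_ : Pol → Pol → Pol
  []      *ₚ r = []
  (a ∷ p) *ₚ r = scale a r +ₚ (0# ∷ (p *ₚ r))

  Xₚ : Pol
  Xₚ = 0# ∷ 1# ∷ []

  negVar : Pol → Pol
  negVar []      = []
  negVar (a ∷ p) = a ∷ map (-_) (negVar p)

  subSq : Pol → Pol
  subSq []      = []
  subSq (a ∷ p) = a ∷ 0# ∷ subSq p

  sign : ℕ → Carrier
  sign zero    = 1#
  sign (suc n) = - sign n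

  sumTo : (ℕ → Carrier) → ℕ → Carrier
  sumTo f zero    = f zero
  sumTo f (suc m) = sumTo f m + f (suc m)

  fromCoeffs : (ℕ → Carrier) → ℕ → Pol
  fromCoeffs f n = map f (upTo (suc n))

  HasDegree : Pol → ℕ → Set
  HasDegree p d = ¬ (coeff p d ≈ 0#) × (∀ i → d ℕ.< i → coeff p i ≈ 0#)

  MonicOfDegree : Pol → ℕ → Set
  MonicOfDegree p d = coeff p d ≈ 1# × (∀ i → d ℕ.< i → coeff p i ≈ 0#)

  IsConstant : Pol → Set
  IsConstant p = ∀ i → 1 ≤ i → coeff p i ≈ 0#

  Irreducible : Pol → Set
  Irreducible p = ¬ IsConstant p × (∀ f g → p ≈ₚ f *ₚ g → IsConstant f ⊎ IsConstant g)

  -- The polynomial A(X) of the corollary, built from C and n: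
  -- A(X) = (-1)^n Σ_{j=0}^{n} Σ_{u=0}^{2j} (-1)^u c_u c_{2j-u} X^j
  -- where c_s = coeff C s (so c_n = 1 and c_s = 0 for s > n when C is monic of degree n).
  Apoly : Pol → ℕ → Pol
  Apoly C n = fromCoeffs
    (λ j → sign n * sumTo (λ u → sign u * (coeff C u * coeff C (2 ℕ.* j ℕ.∸ u))) (2 ℕ.* j)) n

module Ext {q r : ℕ} (F : FiniteField q) (E : FiniteField r) (ι : RingHom F E) where
  private module F = FiniteField F
  open FiniteField E
  open RingHom ι
  open Poly F using (Pol; coeff; _≈ₚ_; MonicOfDegree; HasDegree)

  eval : Pol → Carrier → Carrier
  eval []      x = 0#
  eval (a ∷ p) x = ⟦ a ⟧ + x * eval p x

  IsMinimalPolynomial : Carrier → Pol → Set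
  IsMinimalPolynomial α m = ∃ λ d → MonicOfDegree m d × eval m α ≈ 0#
    × (∀ f → ¬ (f ≈ₚ []) → eval f α ≈ 0# → ∀ e → HasDegree f e → d ≤ e)

power : ∀ {r} (E : FiniteField r) → FiniteField.Carrier E → ℕ → FiniteField.Carrier E
power E x zero    = FiniteField.1# E
power E x (suc n) = FiniteField._*_ E x (power E x n)

IsOrder : ∀ {r} (E : FiniteField r) → FiniteField.Carrier E → ℕ → Set
IsOrder E x e = 1 ≤ e × FiniteField._≈_ E (power E x e) (FiniteField.1# E)
  × (∀ d → 1 ≤ d → FiniteField._≈_ E (power E x d) (FiniteField.1# E) → e ≤ d)

divGcd2 : ℕ → ℕ
divGcd2 e = _/_ e (gcd 2 e) {{≢-nonZero (λ eq → lem (gcd[m,n]≡0⇒m≡0 {2} {e} eq))}}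
  where
  lem : 2 ≡ 0 → Data.Empty.⊥
  lem ()

module Submission where

-- Write C⁻(X) = (-1)ⁿ C(-X). Since 2 is invertible (q is odd), the odd coefficients of
-- C·C⁻, being antisymmetric sums, vanish; so C·C⁻ = A(X²), with A read off coefficientwise,
-- monic of degree n by looking at the leading term.
-- If some odd coefficient of C is nonzero then C and C(-X) are coprime. For a factorisation
-- A = f g, the prime C divides f(X²) or g(X²), say f(X²); applying X ↦ -X, so does C(-X),
-- hence C·C(-X) ∣ f(X²), and comparing degrees g is constant. If all odd coefficients vanish,
-- then C = E(X²) with n even and A = E² is reducible.
-- Finally β² is a root of the irreducible A, so A is its minimal polynomial, and all roots γ
-- of A satisfy the same equations γᵐ = 1, namely those with ord β ∣ 2m.

open import Level using (0ℓ)
open import Algebra.Bundles using (CommutativeRing)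
import Algebra.Properties.Ring
import Algebra.Solver.Ring.NaturalCoefficients.Default
open import Data.Empty using (⊥-elim)
open import Data.Fin as Fin using (Fin)
import Data.Fin.Properties as FinP
open import Data.List as List using (List; []; _∷_)
open import Data.Nat as ℕ using (ℕ; zero; suc; _≤_; _<_; z≤n; s≤s; _^_; _%_; _/_; NonZero)
import Data.Nat.Properties as ℕP
import Data.Nat.DivMod as ℕD
open import Data.Nat.Divisibility as ℕDiv using (_∣_; divides)
open import Data.Nat.GCD using (gcd; gcd[m,n]∣n; gcd[m,n]∣m; gcd-comm; gcd[m,n]≡0⇒m≡0)
open import Data.Nat.Coprimality using (coprime-divisor; gcd≡1⇒coprime)
open import Data.Product using (∃; ∃₂; _×_; _,_; proj₁; proj₂)
open import Data.Sum using (_⊎_; inj₁; inj₂; [_,_]′; reduce)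
open import Function.Base using (_∘_)
open import Function.Bundles using (_⇔_; mk⇔)
open import Relation.Binary.Definitions using (tri<; tri≈; tri>)
open import Relation.Binary.PropositionalEquality using (_≡_)
import Relation.Binary.PropositionalEquality as ≡
import Relation.Binary.Reasoning.Setoid
open import Relation.Nullary using (¬_; Dec; yes; no; ¬?)
open import Relation.Nullary.Decidable using (map′; _×-dec_; decidable-stable)

open import Defs

double : ℕ → ℕ
double zero    = zero
double (suc j) = suc (suc (double j))

double≡2* : ∀ j → double j ≡ 2 ℕ.* j
double≡2* zero    = ≡.refl
double≡2* (suc j) = ≡.trans (≡.cong (λ x → suc (suc x)) (double≡2* j)) (≡.sym (ℕP.*-distribˡ-+ 2 1 j))

double≡+ : ∀ j → double j ≡ j ℕ.+ j
double≡+ j = ≡.trans (double≡2* j) (≡.cong (j ℕ.+_) (ℕP.+-identityʳ j))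

even⊎odd : ∀ i → ∃ λ j → i ≡ double j ⊎ i ≡ suc (double j)
even⊎odd zero = 0 , inj₁ ≡.refl
even⊎odd (suc i) with even⊎odd i
... | j , inj₁ e = j , inj₂ (≡.cong suc e)
... | j , inj₂ e = suc j , inj₁ (≡.cong suc e)

double-cancel-< : ∀ {j k} → double k < double j → k < j
double-cancel-< {suc j} {zero}  _                 = s≤s z≤n
double-cancel-< {suc j} {suc k} (s≤s (s≤s k<j)) = s≤s (double-cancel-< k<j)

double%2≡0 : ∀ j → double j % 2 ≡ 0
double%2≡0 j = ≡.subst (λ k → k % 2 ≡ 0) (≡.sym (≡.trans (double≡2* j) (ℕP.*-comm 2 j))) (ℕD.m*n%n≡0 j 2)

suc-double%2≡1 : ∀ j → suc (double j) % 2 ≡ 1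
suc-double%2≡1 j = ≡.subst (λ k → k % 2 ≡ 1) (≡.sym (≡.cong suc (≡.trans (double≡2* j) (ℕP.*-comm 2 j)))) (ℕD.[m+kn]%n≡m%n 1 j 2)

k+l≡n∧2k≡2n+m⇒l≡0 : ∀ k l m n → k ℕ.+ l ≡ n → double k ≡ (n ℕ.+ n) ℕ.+ m → l ≡ 0
k+l≡n∧2k≡2n+m⇒l≡0 k zero    m n _     _ = ≡.refl
k+l≡n∧2k≡2n+m⇒l≡0 k (suc l) m n k+l≡n 2k≡2n+m =
  ⊥-elim (ℕP.<-irrefl 2k≡2n+m (ℕP.<-≤-trans 2k<2n (ℕP.m≤m+n (n ℕ.+ n) m)))
  where
  k<n : k < n
  k<n = ≡.subst (k <_) k+l≡n (ℕP.m<m+n k (s≤s z≤n))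
  2k<2n : double k < n ℕ.+ n
  2k<2n = ≡.subst (_< n ℕ.+ n) (≡.sym (double≡+ k)) (ℕP.+-mono-< k<n k<n)

m+n<o⇒n<o∸m : ∀ m n o → m ℕ.+ n < o → n < o ℕ.∸ m
m+n<o⇒n<o∸m zero    n o       m+n<o          = m+n<o
m+n<o⇒n<o∸m (suc m) n (suc o) (s≤s m+n<o) = m+n<o⇒n<o∸m m n o m+n<o

CharacteristicNot2 : ∀ {q} → FiniteField q → Set
CharacteristicNot2 F = ¬ 1# + 1# ≈ 0#
  where open FiniteField F

module Field {q : ℕ} (F : FiniteField q) where
  open FiniteField F public
  open Poly F public
  open import Algebra.Properties.Ring ring public
  open import Relation.Binary.Reasoning.Setoid setoid public
  import Algebra.Solver.Ring.NaturalCoefficients.Default commutativeSemiring as Solver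
  open Solver public using (solve; _:=_; _:+_; _:*_; con)

  infix 4 _≈?_
  _≈?_ : (x y : Carrier) → Dec (x ≈ y)
  x ≈? y with enum-surj x | enum-surj y
  ... | i , ei | j , ej with i Fin.≟ j
  ... | yes ≡.refl = yes (trans (sym ei) ej)
  ... | no i≢j     = no (λ x≈y → i≢j (enum-inj i j (trans ei (trans x≈y (sym ej)))))

  *-cancelˡ-nonzero : ∀ {c x y} → ¬ c ≈ 0# → c * x ≈ c * y → x ≈ y
  *-cancelˡ-nonzero {c} {x} {y} c≉0 eq with inverse c c≉0
  ... | w , cw≈1 = begin
      x               ≈⟨ sym (*-identityˡ x) ⟩
      1# * x          ≈⟨ *-congʳ (sym cw≈1) ⟩
      (c * w) * x     ≈⟨ solve 3 (λ c w x → (c :* w) :* x := w :* (c :* x)) refl c w x ⟩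
      w * (c * x)     ≈⟨ *-congˡ eq ⟩
      w * (c * y)     ≈⟨ solve 3 (λ c w y → w :* (c :* y) := (c :* w) :* y) refl c w y ⟩
      (c * w) * y     ≈⟨ *-congʳ cw≈1 ⟩
      1# * y          ≈⟨ *-identityˡ y ⟩
      y               ∎

  x*y≈0⇒x≈0⊎y≈0 : ∀ x y → x * y ≈ 0# → x ≈ 0# ⊎ y ≈ 0#
  x*y≈0⇒x≈0⊎y≈0 x y xy≈0 with x ≈? 0#
  ... | yes x≈0 = inj₁ x≈0
  ... | no x≉0  = inj₂ (*-cancelˡ-nonzero x≉0 (trans xy≈0 (sym (zeroʳ x))))

  x≉0∧y≉0⇒x*y≉0 : ∀ {x y} → ¬ x ≈ 0# → ¬ y ≈ 0# → ¬ x * y ≈ 0#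
  x≉0∧y≉0⇒x*y≉0 {x} {y} x≉0 y≉0 xy≈0 with x*y≈0⇒x≈0⊎y≈0 x y xy≈0
  ... | inj₁ x≈0 = x≉0 x≈0
  ... | inj₂ y≈0 = y≉0 y≈0

  -x*-y≈x*y : ∀ x y → - x * - y ≈ x * y
  -x*-y≈x*y x y = begin
      - x * - y     ≈⟨ sym (-‿distribˡ-* x (- y)) ⟩
      - (x * - y)   ≈⟨ -‿cong (sym (-‿distribʳ-* x y)) ⟩
      - - (x * y)   ≈⟨ -‿involutive (x * y) ⟩
      x * y         ∎

  x≈-x⇒x≈0 : CharacteristicNot2 F → ∀ x → x ≈ - x → x ≈ 0#
  x≈-x⇒x≈0 1+1≉0 x x≈-x with x*y≈0⇒x≈0⊎y≈0 (1# + 1#) x (begin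
      (1# + 1#) * x      ≈⟨ distribʳ x 1# 1# ⟩
      1# * x + 1# * x    ≈⟨ +-cong (*-identityˡ x) (*-identityˡ x) ⟩
      x + x              ≈⟨ +-congʳ x≈-x ⟩
      - x + x            ≈⟨ -‿inverseˡ x ⟩
      0#                 ∎)
  ... | inj₁ 1+1≈0 = ⊥-elim (1+1≉0 1+1≈0)
  ... | inj₂ x≈0   = x≈0

  sign²≈1 : ∀ m → sign m * sign m ≈ 1#
  sign²≈1 zero    = *-identityˡ 1#
  sign²≈1 (suc m) = trans (-x*-y≈x*y (sign m) (sign m)) (sign²≈1 m)

  sign≉0 : ∀ m → ¬ sign m ≈ 0#
  sign≉0 m sign≈0 = 1≉0 (begin
      1#                ≈⟨ sym (sign²≈1 m) ⟩
      sign m * sign m   ≈⟨ *-congʳ sign≈0 ⟩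
      0# * sign m       ≈⟨ zeroˡ _ ⟩
      0#                ∎)

  sign-+ : ∀ m n → sign (m ℕ.+ n) ≈ sign m * sign n
  sign-+ zero    n = sym (*-identityˡ (sign n))
  sign-+ (suc m) n = trans (-‿cong (sign-+ m n)) (-‿distribˡ-* (sign m) (sign n))

  sign-double : ∀ j → sign (double j) ≈ 1#
  sign-double j = trans (≡.subst (λ k → sign k ≈ sign (j ℕ.+ j)) (≡.sym (double≡+ j)) refl)
                        (trans (sign-+ j j) (sign²≈1 j))

  sign-odd : ∀ i → i % 2 ≡ 1 → sign i ≈ - 1#
  sign-odd i i-odd with even⊎odd i
  ... | j , inj₁ ≡.refl = ⊥-elim (ℕP.0≢1+n (≡.trans (≡.sym (double%2≡0 j)) i-odd))
  ... | j , inj₂ ≡.refl = -‿cong (sign-double j)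

  sign-∸ : ∀ {u k} → u ≤ k → sign (k ℕ.∸ u) ≈ sign k * sign u
  sign-∸ {u} {k} u≤k = begin
      sign (k ℕ.∸ u)                         ≈⟨ sym (*-identityʳ _) ⟩
      sign (k ℕ.∸ u) * 1#                    ≈⟨ *-congˡ (sym (sign²≈1 u)) ⟩
      sign (k ℕ.∸ u) * (sign u * sign u)     ≈⟨ sym (*-assoc _ _ _) ⟩
      (sign (k ℕ.∸ u) * sign u) * sign u     ≈⟨ *-congʳ (sym (sign-+ (k ℕ.∸ u) u)) ⟩
      sign (k ℕ.∸ u ℕ.+ u) * sign u          ≈⟨ *-congʳ (≡.subst (λ i → sign i ≈ sign k) (≡.sym (ℕP.m∸n+n≡m u≤k)) refl) ⟩
      sign k * sign u                        ∎

  sumTo-cong : ∀ {f g} m → (∀ u → u ≤ m → f u ≈ g u) → sumTo f m ≈ sumTo g m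
  sumTo-cong zero    f≈g = f≈g 0 z≤n
  sumTo-cong (suc m) f≈g = +-cong (sumTo-cong m (λ u u≤m → f≈g u (ℕP.m≤n⇒m≤1+n u≤m))) (f≈g (suc m) ℕP.≤-refl)

  sumTo-≈0 : ∀ {f} m → (∀ u → u ≤ m → f u ≈ 0#) → sumTo f m ≈ 0#
  sumTo-≈0 m f≈0 = trans (sumTo-cong m f≈0) (lemma m)
    where
    lemma : ∀ m → sumTo (λ _ → 0#) m ≈ 0#
    lemma zero    = refl
    lemma (suc m) = trans (+-identityʳ _) (lemma m)

  sumTo-*ˡ : ∀ c f m → sumTo (λ u → c * f u) m ≈ c * sumTo f m
  sumTo-*ˡ c f zero    = refl
  sumTo-*ˡ c f (suc m) = trans (+-congʳ (sumTo-*ˡ c f m)) (sym (distribˡ c (sumTo f m) (f (suc m))))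

  sumTo-+ : ∀ f g m → sumTo (λ u → f u + g u) m ≈ sumTo f m + sumTo g m
  sumTo-+ f g zero    = refl
  sumTo-+ f g (suc m) = trans (+-congʳ (sumTo-+ f g m))
    (solve 4 (λ a b c d → (a :+ b) :+ (c :+ d) := (a :+ c) :+ (b :+ d)) refl (sumTo f m) (sumTo g m) (f (suc m)) (g (suc m)))

  sumTo-neg : ∀ f m → sumTo (λ u → - f u) m ≈ - sumTo f m
  sumTo-neg f m = trans (sumTo-cong m (λ u _ → sym (-1*x≈-x (f u)))) (trans (sumTo-*ˡ (- 1#) f m) (-1*x≈-x _))

  sumTo-suc : ∀ f m → sumTo f (suc m) ≈ f 0 + sumTo (λ u → f (suc u)) m
  sumTo-suc f zero    = refl
  sumTo-suc f (suc m) = trans (+-congʳ (sumTo-suc f m)) (+-assoc _ _ _)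

  sumTo-reverse : ∀ f m → sumTo f m ≈ sumTo (λ u → f (m ℕ.∸ u)) m
  sumTo-reverse f zero    = refl
  sumTo-reverse f (suc m) = begin
      sumTo f m + f (suc m)                          ≈⟨ +-congʳ (sumTo-reverse f m) ⟩
      sumTo (λ u → f (m ℕ.∸ u)) m + f (suc m)        ≈⟨ +-comm _ _ ⟩
      f (suc m) + sumTo (λ u → f (m ℕ.∸ u)) m        ≈⟨ sym (sumTo-suc (λ u → f (suc m ℕ.∸ u)) m) ⟩
      sumTo (λ u → f (suc m ℕ.∸ u)) (suc m)          ∎

  sumTo-single : ∀ {f} m t → t ≤ m → (∀ u → u ≤ m → ¬ u ≡ t → f u ≈ 0#) → sumTo f m ≈ f t
  sumTo-single zero .zero z≤n _ = refl
  sumTo-single (suc m) t t≤ others≈0 with t ℕ.≟ suc m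
  ... | yes ≡.refl = trans (+-congʳ (sumTo-≈0 m (λ u u≤m → others≈0 u (ℕP.m≤n⇒m≤1+n u≤m) (ℕP.<⇒≢ (s≤s u≤m)))))
                           (+-identityˡ _)
  ... | no t≢ = trans (+-congˡ (others≈0 (suc m) ℕP.≤-refl (λ e → t≢ (≡.sym e))))
                  (trans (+-identityʳ _) (sumTo-single m t (ℕP.≤-pred (ℕP.≤∧≢⇒< t≤ t≢))
                                            (λ u u≤m → others≈0 u (ℕP.m≤n⇒m≤1+n u≤m))))

module FixedPointFreeInvolution {A : Set} (_≟_ : (x y : A) → Dec (x ≡ y)) (τ : A → A)
         (τ-involutive : ∀ x → τ (τ x) ≡ x) (τ-fixedPointFree : ∀ x → ¬ τ x ≡ x) where
  open import Data.List using (length; filter)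
  import Data.List.Properties as List
  open import Data.List.Relation.Unary.All as All using ()
  open import Data.List.Relation.Unary.Any using (here; there)
  open import Data.List.Relation.Unary.AllPairs using (_∷_)
  open import Data.List.Relation.Unary.Unique.Propositional using (Unique)
  import Data.List.Relation.Unary.Unique.Propositional.Properties as Unique
  open import Data.List.Membership.Propositional using (_∈_)
  import Data.List.Membership.Propositional.Properties as ∈

  Closed : List A → Set
  Closed xs = ∀ {x} → x ∈ xs → τ x ∈ xs

  private
    remove : A → List A → List A
    remove y = filter (λ z → ¬? (z ≟ y))

    length-remove : ∀ y ys → Unique ys → y ∈ ys → length ys ≡ suc (length (remove y ys))
    length-remove y (w ∷ ws) (w∉ws ∷ _) y∈ with w ≟ y
    ... | yes ≡.refl = ≡.cong suc (≡.sym (≡.cong length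
            (List.filter-all (λ z → ¬? (z ≟ w)) (All.map (λ w≢z z≡w → w≢z (≡.sym z≡w)) w∉ws))))
    length-remove y (w ∷ ws) _          (here y≡w) | no w≢y = ⊥-elim (w≢y (≡.sym y≡w))
    length-remove y (w ∷ ws) (_ ∷ uws) (there y∈) | no w≢y = ≡.cong suc (length-remove y ws uws y∈)

  -- Remove x together with τ x; N bounds the length so that the recursion is structural.
  closed⇒even-length : ∀ N xs → length xs ≤ N → Unique xs → Closed xs → ∃ λ k → length xs ≡ 2 ℕ.* k
  closed⇒even-length N [] _ _ _ = 0 , ≡.refl
  closed⇒even-length (suc N) (x ∷ ys) (s≤s len≤N) (x∉ys ∷ uys) closed =
    suc (proj₁ rest) , ≡.trans (≡.cong suc (≡.trans len-ys (≡.cong suc (proj₂ rest)))) (≡.sym (ℕP.*-distribˡ-+ 2 1 (proj₁ rest)))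
    where
    y : A
    y = τ x
    y∈ys : y ∈ ys
    y∈ys with closed (here ≡.refl)
    ... | here τx≡x = ⊥-elim (τ-fixedPointFree x τx≡x)
    ... | there y∈  = y∈
    zs : List A
    zs = remove y ys
    len-ys : length ys ≡ suc (length zs)
    len-ys = length-remove y ys uys y∈ys
    zs-closed : Closed zs
    zs-closed {z} z∈zs with ∈.∈-filter⁻ (λ z → ¬? (z ≟ y)) {xs = ys} z∈zs
    ... | z∈ys , z≢y = ∈.∈-filter⁺ (λ z → ¬? (z ≟ y)) τz∈ys τz≢y
      where
      τz≢x : ¬ τ z ≡ x
      τz≢x e = z≢y (≡.trans (≡.sym (τ-involutive z)) (≡.cong τ e))
      τz∈ys : τ z ∈ ys
      τz∈ys with closed (there z∈ys)
      ... | here e    = ⊥-elim (τz≢x e)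
      ... | there τz∈ = τz∈
      τz≢y : ¬ τ z ≡ y
      τz≢y e = All.lookup x∉ys z∈ys (≡.sym (≡.trans (≡.sym (τ-involutive z)) (≡.trans (≡.cong τ e) (τ-involutive x))))
    rest : ∃ λ k → length zs ≡ 2 ℕ.* k
    rest = closed⇒even-length N zs (ℕP.≤-trans (ℕP.n≤1+n _) (≡.subst (_≤ N) len-ys len≤N))
                               (Unique.filter⁺ (λ z → ¬? (z ≟ y)) uys) zs-closed

module _ {q : ℕ} (F : FiniteField q) where
  open Field F
  open import Data.List using (length; allFin)
  open import Data.List.Properties using (length-tabulate)
  open import Data.List.Relation.Unary.Unique.Propositional.Properties using (allFin⁺)
  open import Data.List.Membership.Propositional.Properties using (∈-allFin)

  -- If 1 + 1 ≈ 0 then x ↦ x + 1 is a fixed-point-free involution of F, so q would be even.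
  odd-cardinality⇒characteristicNot2 : q % 2 ≡ 1 → CharacteristicNot2 F
  odd-cardinality⇒characteristicNot2 q-odd 1+1≈0 = ℕP.0≢1+n (≡.trans (≡.sym q-even) q-odd)
    where
    τ : Fin q → Fin q
    τ i = proj₁ (enum-surj (enum i + 1#))
    enum-τ : ∀ i → enum (τ i) ≈ enum i + 1#
    enum-τ i = proj₂ (enum-surj (enum i + 1#))
    τ-involutive : ∀ i → τ (τ i) ≡ i
    τ-involutive i = enum-inj _ _ (begin
      enum (τ (τ i))       ≈⟨ enum-τ (τ i) ⟩
      enum (τ i) + 1#      ≈⟨ +-congʳ (enum-τ i) ⟩
      (enum i + 1#) + 1#   ≈⟨ +-assoc _ _ _ ⟩
      enum i + (1# + 1#)   ≈⟨ +-congˡ 1+1≈0 ⟩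
      enum i + 0#          ≈⟨ +-identityʳ _ ⟩
      enum i               ∎)
    τ-fixedPointFree : ∀ i → ¬ τ i ≡ i
    τ-fixedPointFree i τi≡i = 1≉0 (begin
      1#                         ≈⟨ sym (+-identityˡ 1#) ⟩
      0# + 1#                    ≈⟨ +-congʳ (sym (-‿inverseˡ (enum i))) ⟩
      (- enum i + enum i) + 1#   ≈⟨ +-assoc _ _ _ ⟩
      - enum i + (enum i + 1#)   ≈⟨ +-congˡ (sym (enum-τ i)) ⟩
      - enum i + enum (τ i)      ≈⟨ +-congˡ (≡.subst (λ j → enum j ≈ enum i) (≡.sym τi≡i) refl) ⟩
      - enum i + enum i          ≈⟨ -‿inverseˡ _ ⟩
      0#                         ∎)
    open FixedPointFreeInvolution Fin._≟_ τ τ-involutive τ-fixedPointFree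
    length-allFin : length (allFin q) ≡ q
    length-allFin = length-tabulate (λ x → x)
    halves : ∃ λ k → length (allFin q) ≡ 2 ℕ.* k
    halves = closed⇒even-length q (allFin q) (ℕP.≤-reflexive length-allFin) (allFin⁺ q) (λ {x} _ → ∈-allFin (τ x))
    q-even : q % 2 ≡ 0
    q-even = ≡.subst (λ x → x % 2 ≡ 0) (≡.trans (ℕP.*-comm (proj₁ halves) 2) (≡.trans (≡.sym (proj₂ halves)) length-allFin))
                     (ℕD.m*n%n≡0 (proj₁ halves) 2)

module Polynomials {q : ℕ} (F : FiniteField q) where
  open Field F public

  -- Wrapped in a record so that both sides of an equation are visible to unification.
  infix 4 _≋_
  record _≋_ (p r : Pol) : Set where
    constructor mk≋
    field un≋ : p ≈ₚ r
  open _≋_ public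

  coeff-+ : ∀ p r i → coeff (p +ₚ r) i ≈ coeff p i + coeff r i
  coeff-+ []      r       i       = sym (+-identityˡ _)
  coeff-+ (a ∷ p) []      i       = sym (+-identityʳ _)
  coeff-+ (a ∷ p) (b ∷ r) zero    = refl
  coeff-+ (a ∷ p) (b ∷ r) (suc i) = coeff-+ p r i

  coeff-map : ∀ (f : Carrier → Carrier) → f 0# ≈ 0# → ∀ p i → coeff (List.map f p) i ≈ f (coeff p i)
  coeff-map f f0≈0 []      i       = sym f0≈0
  coeff-map f f0≈0 (a ∷ p) zero    = refl
  coeff-map f f0≈0 (a ∷ p) (suc i) = coeff-map f f0≈0 p i

  coeff-scale : ∀ c p i → coeff (scale c p) i ≈ c * coeff p i
  coeff-scale c = coeff-map (c *_) (zeroʳ c)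

  -ₚ_ : Pol → Pol
  -ₚ_ = List.map (-_)

  coeff-neg : ∀ p i → coeff (-ₚ p) i ≈ - coeff p i
  coeff-neg = coeff-map (-_) -0#≈0#

  coeff-negVar : ∀ p i → coeff (negVar p) i ≈ sign i * coeff p i
  coeff-negVar []      i       = sym (zeroʳ _)
  coeff-negVar (a ∷ p) zero    = sym (*-identityˡ a)
  coeff-negVar (a ∷ p) (suc i) =
    trans (coeff-neg (negVar p) i) (trans (-‿cong (coeff-negVar p i)) (-‿distribˡ-* _ _))

  coeff-subSq-double : ∀ p j → coeff (subSq p) (double j) ≈ coeff p j
  coeff-subSq-double []      j       = refl
  coeff-subSq-double (a ∷ p) zero    = refl
  coeff-subSq-double (a ∷ p) (suc j) = coeff-subSq-double p j

  coeff-subSq-suc-double : ∀ p j → coeff (subSq p) (suc (double j)) ≈ 0#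
  coeff-subSq-suc-double []      j       = refl
  coeff-subSq-suc-double (a ∷ p) zero    = refl
  coeff-subSq-suc-double (a ∷ p) (suc j) = coeff-subSq-suc-double p j

  convolution : Pol → Pol → ℕ → Carrier
  convolution p r k = sumTo (λ u → coeff p u * coeff r (k ℕ.∸ u)) k

  coeff-* : ∀ p r k → coeff (p *ₚ r) k ≈ convolution p r k
  coeff-* []      r k       = sym (sumTo-≈0 k (λ u _ → zeroˡ _))
  coeff-* (a ∷ p) r zero    = trans (coeff-+ (scale a r) (0# ∷ p *ₚ r) 0)
                                    (trans (+-congʳ (coeff-scale a r 0)) (+-identityʳ _))
  coeff-* (a ∷ p) r (suc k) = begin
      coeff (scale a r +ₚ (0# ∷ p *ₚ r)) (suc k)     ≈⟨ coeff-+ (scale a r) (0# ∷ p *ₚ r) (suc k) ⟩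
      coeff (scale a r) (suc k) + coeff (p *ₚ r) k    ≈⟨ +-cong (coeff-scale a r (suc k)) (coeff-* p r k) ⟩
      a * coeff r (suc k) + convolution p r k         ≈⟨ sym (sumTo-suc (λ u → coeff (a ∷ p) u * coeff r (suc k ℕ.∸ u)) k) ⟩
      convolution (a ∷ p) r (suc k)                   ∎

  *ₚ-cong : ∀ {p p' r r'} → p ≋ p' → r ≋ r' → p *ₚ r ≋ p' *ₚ r'
  *ₚ-cong {p} {p'} {r} {r'} (mk≋ p≈p') (mk≋ r≈r') = mk≋ λ k → begin
      coeff (p *ₚ r) k       ≈⟨ coeff-* p r k ⟩
      convolution p r k      ≈⟨ sumTo-cong k (λ u _ → *-cong (p≈p' u) (r≈r' (k ℕ.∸ u))) ⟩
      convolution p' r' k    ≈⟨ sym (coeff-* p' r' k) ⟩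
      coeff (p' *ₚ r') k     ∎

  +ₚ-cong : ∀ {p p' r r'} → p ≋ p' → r ≋ r' → p +ₚ r ≋ p' +ₚ r'
  +ₚ-cong {p} {p'} {r} {r'} (mk≋ p≈p') (mk≋ r≈r') = mk≋ λ k →
    trans (coeff-+ p r k) (trans (+-cong (p≈p' k) (r≈r' k)) (sym (coeff-+ p' r' k)))

  -ₚ-cong : ∀ {p p'} → p ≋ p' → -ₚ p ≋ -ₚ p'
  -ₚ-cong {p} {p'} (mk≋ p≈p') = mk≋ λ k → trans (coeff-neg p k) (trans (-‿cong (p≈p' k)) (sym (coeff-neg p' k)))

  ∷-cong : ∀ {a b p r} → a ≈ b → p ≋ r → (a ∷ p) ≈ₚ (b ∷ r)
  ∷-cong a≈b (mk≋ p≈r) zero    = a≈b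
  ∷-cong a≈b (mk≋ p≈r) (suc i) = p≈r i

  *ₚ-comm : ∀ p r → p *ₚ r ≈ₚ r *ₚ p
  *ₚ-comm p r k = begin
      coeff (p *ₚ r) k                                               ≈⟨ coeff-* p r k ⟩
      convolution p r k                                              ≈⟨ sumTo-reverse _ k ⟩
      sumTo (λ u → coeff p (k ℕ.∸ u) * coeff r (k ℕ.∸ (k ℕ.∸ u))) k  ≈⟨ sumTo-cong k swap ⟩
      convolution r p k                                              ≈⟨ sym (coeff-* r p k) ⟩
      coeff (r *ₚ p) k                                               ∎
    where
    swap : ∀ u → u ≤ k → coeff p (k ℕ.∸ u) * coeff r (k ℕ.∸ (k ℕ.∸ u)) ≈ coeff r u * coeff p (k ℕ.∸ u)
    swap u u≤k = trans (*-comm _ _) (*-congʳ (≡.subst (λ x → coeff r x ≈ coeff r u) (≡.sym (ℕP.m∸[m∸n]≡n u≤k)) refl))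

  *ₚ-distribʳ : ∀ r p p' → (p +ₚ p') *ₚ r ≈ₚ p *ₚ r +ₚ p' *ₚ r
  *ₚ-distribʳ r p p' k = begin
      coeff ((p +ₚ p') *ₚ r) k                       ≈⟨ coeff-* (p +ₚ p') r k ⟩
      convolution (p +ₚ p') r k                      ≈⟨ sumTo-cong k (λ u _ → trans (*-congʳ (coeff-+ p p' u)) (distribʳ _ _ _)) ⟩
      sumTo (λ u → coeff p u * coeff r (k ℕ.∸ u) + coeff p' u * coeff r (k ℕ.∸ u)) k
                                                     ≈⟨ sumTo-+ _ _ k ⟩
      convolution p r k + convolution p' r k         ≈⟨ sym (+-cong (coeff-* p r k) (coeff-* p' r k)) ⟩
      coeff (p *ₚ r) k + coeff (p' *ₚ r) k           ≈⟨ sym (coeff-+ (p *ₚ r) (p' *ₚ r) k) ⟩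
      coeff (p *ₚ r +ₚ p' *ₚ r) k                    ∎

  scale-*ₚ : ∀ c p r → scale c p *ₚ r ≈ₚ scale c (p *ₚ r)
  scale-*ₚ c p r k = begin
      coeff (scale c p *ₚ r) k                        ≈⟨ coeff-* (scale c p) r k ⟩
      convolution (scale c p) r k                     ≈⟨ sumTo-cong k (λ u _ → trans (*-congʳ (coeff-scale c p u)) (*-assoc _ _ _)) ⟩
      sumTo (λ u → c * (coeff p u * coeff r (k ℕ.∸ u))) k ≈⟨ sumTo-*ˡ c _ k ⟩
      c * convolution p r k                           ≈⟨ *-congˡ (sym (coeff-* p r k)) ⟩
      c * coeff (p *ₚ r) k                            ≈⟨ sym (coeff-scale c (p *ₚ r) k) ⟩
      coeff (scale c (p *ₚ r)) k                      ∎

  X*ₚ : ∀ p r → (0# ∷ p) *ₚ r ≈ₚ 0# ∷ (p *ₚ r)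
  X*ₚ p r k = trans (coeff-+ (scale 0# r) (0# ∷ p *ₚ r) k)
                    (trans (+-congʳ (trans (coeff-scale 0# r k) (zeroˡ _))) (+-identityˡ _))

  *ₚ-assoc : ∀ p r s → (p *ₚ r) *ₚ s ≈ₚ p *ₚ (r *ₚ s)
  *ₚ-assoc []      r s _ = refl
  *ₚ-assoc (a ∷ p) r s k =
    trans (*ₚ-distribʳ s (scale a r) (0# ∷ p *ₚ r) k)
          (un≋ (+ₚ-cong {scale a r *ₚ s} {scale a (r *ₚ s)} {(0# ∷ p *ₚ r) *ₚ s} {0# ∷ p *ₚ (r *ₚ s)} (mk≋ (scale-*ₚ a r s)) (mk≋ (λ i → trans (X*ₚ (p *ₚ r) s i) (∷-cong {p = (p *ₚ r) *ₚ s} refl (mk≋ (*ₚ-assoc p r s)) i)))) k)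

  const : Carrier → Pol
  const c = c ∷ []

  1ₚ : Pol
  1ₚ = const 1#

  const-*ₚ : ∀ c p → const c *ₚ p ≈ₚ scale c p
  const-*ₚ c p k = trans (coeff-+ (scale c p) (0# ∷ []) k) (trans (+-congˡ (coeff-0 k)) (+-identityʳ _))
    where
    coeff-0 : ∀ k → coeff (0# ∷ []) k ≈ 0#
    coeff-0 zero    = refl
    coeff-0 (suc k) = refl

  *ₚ-identityˡ : ∀ p → 1ₚ *ₚ p ≈ₚ p
  *ₚ-identityˡ p k = trans (const-*ₚ 1# p k) (trans (coeff-scale 1# p k) (*-identityˡ _))

  +ₚ-assoc : ∀ p r s → (p +ₚ r) +ₚ s ≈ₚ p +ₚ (r +ₚ s)
  +ₚ-assoc p r s k = begin
      coeff ((p +ₚ r) +ₚ s) k              ≈⟨ trans (coeff-+ (p +ₚ r) s k) (+-congʳ (coeff-+ p r k)) ⟩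
      (coeff p k + coeff r k) + coeff s k  ≈⟨ +-assoc _ _ _ ⟩
      coeff p k + (coeff r k + coeff s k)  ≈⟨ sym (trans (coeff-+ p (r +ₚ s) k) (+-congˡ (coeff-+ r s k))) ⟩
      coeff (p +ₚ (r +ₚ s)) k              ∎

  +ₚ-comm : ∀ p r → p +ₚ r ≈ₚ r +ₚ p
  +ₚ-comm p r k = trans (coeff-+ p r k) (trans (+-comm _ _) (sym (coeff-+ r p k)))

  +ₚ-identityʳ : ∀ p → p +ₚ [] ≈ₚ p
  +ₚ-identityʳ p k = trans (coeff-+ p [] k) (+-identityʳ _)

  -ₚ-inverseˡ : ∀ p → (-ₚ p) +ₚ p ≈ₚ []
  -ₚ-inverseˡ p k = trans (coeff-+ (-ₚ p) p k) (trans (+-congʳ (coeff-neg p k)) (-‿inverseˡ (coeff p k)))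

  open import Algebra.Structures _≋_ using (IsCommutativeRing)
  open import Relation.Binary.Structures using (IsEquivalence)

  ≋-isEquivalence : IsEquivalence _≋_
  ≋-isEquivalence = record
    { refl  = mk≋ (λ _ → refl)
    ; sym   = λ (mk≋ e) → mk≋ (λ i → sym (e i))
    ; trans = λ (mk≋ e) (mk≋ f) → mk≋ (λ i → trans (e i) (f i))
    }

  ≋-isCommutativeRing : IsCommutativeRing _+ₚ_ _*ₚ_ -ₚ_ [] 1ₚ
  ≋-isCommutativeRing = record
    { isRing = record
      { +-isAbelianGroup = record
        { isGroup = record
          { isMonoid = record
            { isSemigroup = record
              { isMagma = record
                { isEquivalence = ≋-isEquivalence
                ; ∙-cong = +ₚ-cong }
              ; assoc = λ p r s → mk≋ (+ₚ-assoc p r s) }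
            ; identity = (λ p → mk≋ (λ _ → refl)) , (λ p → mk≋ (+ₚ-identityʳ p)) }
          ; inverse = (λ p → mk≋ (-ₚ-inverseˡ p))
                    , (λ p → mk≋ (λ k → trans (+ₚ-comm p (-ₚ p) k) (-ₚ-inverseˡ p k)))
          ; ⁻¹-cong = -ₚ-cong }
        ; comm = λ p r → mk≋ (+ₚ-comm p r) }
      ; *-cong = *ₚ-cong
      ; *-assoc = λ p r s → mk≋ (*ₚ-assoc p r s)
      ; *-identity = (λ p → mk≋ (*ₚ-identityˡ p))
                   , (λ p → mk≋ (λ k → trans (*ₚ-comm p 1ₚ k) (*ₚ-identityˡ p k)))
      ; distrib = (λ r p p' → mk≋ (λ k → trans (*ₚ-comm r (p +ₚ p') k)
                                      (trans (*ₚ-distribʳ r p p' k) (un≋ (+ₚ-cong {p *ₚ r} {r *ₚ p} {p' *ₚ r} {r *ₚ p'} (mk≋ (*ₚ-comm p r)) (mk≋ (*ₚ-comm p' r))) k))))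
                , (λ r p p' → mk≋ (*ₚ-distribʳ r p p')) }
    ; *-comm = λ p r → mk≋ (*ₚ-comm p r) }

  polynomialRing : CommutativeRing 0ℓ 0ℓ
  polynomialRing = record { isCommutativeRing = ≋-isCommutativeRing }

  module Pₚ = CommutativeRing polynomialRing
  module Pₚ-Properties = Algebra.Properties.Ring Pₚ.ring
  module ≋R = Relation.Binary.Reasoning.Setoid Pₚ.setoid
  open Algebra.Solver.Ring.NaturalCoefficients.Default Pₚ.commutativeSemiring public
    using () renaming (solve to solveₚ; _:+_ to _:+ₚ_; _:*_ to _:*ₚ_; _:=_ to _:=ₚ_)

  +ₚ-congˡ : ∀ r {p p'} → p ≋ p' → r +ₚ p ≋ r +ₚ p'
  +ₚ-congˡ r = +ₚ-cong (Pₚ.refl {r})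

  +ₚ-congʳ : ∀ r {p p'} → p ≋ p' → p +ₚ r ≋ p' +ₚ r
  +ₚ-congʳ r p≋p' = +ₚ-cong p≋p' (Pₚ.refl {r})

  *ₚ-congˡ : ∀ r {p p'} → p ≋ p' → r *ₚ p ≋ r *ₚ p'
  *ₚ-congˡ r = *ₚ-cong (Pₚ.refl {r})

  *ₚ-congʳ : ∀ r {p p'} → p ≋ p' → p *ₚ r ≋ p' *ₚ r
  *ₚ-congʳ r p≋p' = *ₚ-cong p≋p' (Pₚ.refl {r})

  x+y≋[x+z]+[y-z] : ∀ x y z → x +ₚ y ≋ (x +ₚ z) +ₚ (y +ₚ -ₚ z)
  x+y≋[x+z]+[y-z] x y z = ≋R.begin
      x +ₚ y                     ≋R.≈⟨ Pₚ.sym (Pₚ.+-identityʳ _) ⟩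
      (x +ₚ y) +ₚ []             ≋R.≈⟨ +ₚ-congˡ (x +ₚ y) (Pₚ.sym (Pₚ.-‿inverseʳ z)) ⟩
      (x +ₚ y) +ₚ (z +ₚ -ₚ z)    ≋R.≈⟨ solveₚ 4 (λ x y z z' → (x :+ₚ y) :+ₚ (z :+ₚ z') :=ₚ (x :+ₚ z) :+ₚ (y :+ₚ z')) Pₚ.refl x y z (-ₚ z) ⟩
      (x +ₚ z) +ₚ (y +ₚ -ₚ z)    ≋R.∎

module Division {q : ℕ} (F : FiniteField q) where
  open Polynomials F public

  Bounded : Pol → ℕ → Set
  Bounded p d = ∀ i → d ≤ i → coeff p i ≈ 0#

  ≈ₚ[]? : ∀ p → Dec (p ≈ₚ [])
  ≈ₚ[]? [] = yes (λ i → refl)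
  ≈ₚ[]? (a ∷ p) with a ≈? 0# | ≈ₚ[]? p
  ... | yes a≈0 | yes p≈0 = yes (λ { zero → a≈0 ; (suc i) → p≈0 i })
  ... | no a≉0  | _       = no (λ a∷p≈0 → a≉0 (a∷p≈0 0))
  ... | _       | no p≉0  = no (λ a∷p≈0 → p≉0 (λ i → a∷p≈0 (suc i)))

  degree : ∀ p → ¬ p ≈ₚ [] → ∃ λ d → HasDegree p d
  degree []      p≉0 = ⊥-elim (p≉0 (λ _ → refl))
  degree (a ∷ p) a∷p≉0 with ≈ₚ[]? p
  ... | yes p≈0 = 0 , (λ a≈0 → a∷p≉0 (λ { zero → a≈0 ; (suc i) → p≈0 i })) , (λ { (suc i) _ → p≈0 i })
  ... | no p≉0 with degree p p≉0
  ...   | d , top≉0 , above≈0 = suc d , top≉0 , (λ { (suc i) (s≤s d<i) → above≈0 i d<i })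

  HasDegree-cong : ∀ {p r d} → p ≋ r → HasDegree p d → HasDegree r d
  HasDegree-cong {d = d} (mk≋ p≈r) (top≉0 , above≈0) =
    (λ r-top≈0 → top≉0 (trans (p≈r d) r-top≈0)) , (λ i d<i → trans (sym (p≈r i)) (above≈0 i d<i))

  HasDegree-unique : ∀ p {d e} → HasDegree p d → HasDegree p e → d ≡ e
  HasDegree-unique p {d} {e} (d-top , d-above) (e-top , e-above) with ℕP.<-cmp d e
  ... | tri< d<e _ _ = ⊥-elim (e-top (d-above e d<e))
  ... | tri≈ _ d≡e _ = d≡e
  ... | tri> _ _ e<d = ⊥-elim (d-top (e-above d e<d))

  HasDegree⇒≉[] : ∀ p {d} → HasDegree p d → ¬ p ≈ₚ []
  HasDegree⇒≉[] p {d} (top≉0 , _) p≈0 = top≉0 (p≈0 d)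

  *ₚ-zeroʳ : ∀ p r → r ≈ₚ [] → p *ₚ r ≈ₚ []
  *ₚ-zeroʳ p r r≈0 k = trans (coeff-* p r k) (sumTo-≈0 k (λ u _ → trans (*-congˡ (r≈0 (k ℕ.∸ u))) (zeroʳ _)))

  *ₚ-zeroˡ : ∀ p r → p ≈ₚ [] → p *ₚ r ≈ₚ []
  *ₚ-zeroˡ p r p≈0 k = trans (*ₚ-comm p r k) (*ₚ-zeroʳ r p p≈0 k)

  *ₚ-leading : ∀ p r a b → Bounded p (suc a) → Bounded r (suc b) →
               coeff (p *ₚ r) (a ℕ.+ b) ≈ coeff p a * coeff r b × Bounded (p *ₚ r) (suc (a ℕ.+ b))
  *ₚ-leading p r a b p<a r<b = top , above
    where
    top : coeff (p *ₚ r) (a ℕ.+ b) ≈ coeff p a * coeff r b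
    top = trans (coeff-* p r (a ℕ.+ b))
      (trans (sumTo-single (a ℕ.+ b) a (ℕP.m≤m+n a b) others≈0)
        (*-congˡ (≡.subst (λ x → coeff r x ≈ coeff r b) (≡.sym (ℕP.m+n∸m≡n a b)) refl)))
      where
      others≈0 : ∀ u → u ≤ a ℕ.+ b → ¬ u ≡ a → coeff p u * coeff r (a ℕ.+ b ℕ.∸ u) ≈ 0#
      others≈0 u _ u≢a with ℕP.<-cmp u a
      ... | tri< u<a _ _ = trans (*-congˡ (r<b _ (m+n<o⇒n<o∸m u b (a ℕ.+ b) (ℕP.+-monoˡ-< b u<a)))) (zeroʳ _)
      ... | tri≈ _ u≡a _ = ⊥-elim (u≢a u≡a)
      ... | tri> _ _ a<u = trans (*-congʳ (p<a u a<u)) (zeroˡ _)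
    above : Bounded (p *ₚ r) (suc (a ℕ.+ b))
    above k a+b<k = trans (coeff-* p r k) (sumTo-≈0 k terms≈0)
      where
      terms≈0 : ∀ u → u ≤ k → coeff p u * coeff r (k ℕ.∸ u) ≈ 0#
      terms≈0 u _ with u ℕ.≤? a
      ... | yes u≤a = trans (*-congˡ (r<b _ (m+n<o⇒n<o∸m u b k (ℕP.<-≤-trans (s≤s (ℕP.+-monoˡ-≤ b u≤a)) a+b<k)))) (zeroʳ _)
      ... | no u≰a  = trans (*-congʳ (p<a u (ℕP.≰⇒> u≰a))) (zeroˡ _)

  HasDegree-*ₚ : ∀ p r {a b} → HasDegree p a → HasDegree r b → HasDegree (p *ₚ r) (a ℕ.+ b)
  HasDegree-*ₚ p r {a} {b} (p-top , p-above) (r-top , r-above) with *ₚ-leading p r a b p-above r-above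
  ... | top , above = (λ top≈0 → x≉0∧y≉0⇒x*y≉0 p-top r-top (trans (sym top) top≈0)) , above

  degree-factors : ∀ P {d} → HasDegree P d → ∀ f g → P ≋ f *ₚ g →
                   ∃₂ λ k l → HasDegree f k × HasDegree g l × k ℕ.+ l ≡ d
  degree-factors P P°d f g P≋fg with ≈ₚ[]? f | ≈ₚ[]? g
  ... | yes f≈0 | _ = ⊥-elim (HasDegree⇒≉[] P P°d (λ i → trans (un≋ P≋fg i) (*ₚ-zeroˡ f g f≈0 i)))
  ... | no _ | yes g≈0 = ⊥-elim (HasDegree⇒≉[] P P°d (λ i → trans (un≋ P≋fg i) (*ₚ-zeroʳ f g g≈0 i)))
  ... | no f≉0 | no g≉0 with degree f f≉0 | degree g g≉0
  ... | k , f°k | l , g°l = k , l , f°k , g°l , HasDegree-unique P (HasDegree-cong (Pₚ.sym P≋fg) (HasDegree-*ₚ f g f°k g°l)) P°d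

  IsConstant⇒≋const : ∀ p → IsConstant p → p ≋ const (coeff p 0)
  IsConstant⇒≋const p p-const = mk≋ (λ { zero → refl ; (suc i) → p-const (suc i) (s≤s z≤n) })

  const-inverse : ∀ {c} → ¬ c ≈ 0# → ∃ λ w → const w *ₚ const c ≋ 1ₚ
  const-inverse {c} c≉0 with inverse c c≉0
  ... | w , cw≈1 = w , mk≋ (λ k → trans (const-*ₚ w (const c) k) (∷-cong (trans (*-comm w c) cw≈1) Pₚ.refl k))

  infix 4 _∣ₚ_
  _∣ₚ_ : Pol → Pol → Set
  a ∣ₚ b = ∃ λ K → b ≋ a *ₚ K

  -- a + X·f = (X·Q')·g + R₁, and subtracting c·g kills the coefficient of Xᵈ in R₁.
  divMod : ∀ g {d} → HasDegree g d → ∀ f → ∃₂ λ Q R → f ≋ Q *ₚ g +ₚ R × Bounded R d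
  divMod g g°d [] = [] , [] , Pₚ.refl , (λ _ _ → refl)
  divMod g {d} g°d@(g-top , g-above) (a ∷ f) with divMod g g°d f | inverse (coeff g d) g-top
  ... | Q' , R' , f≋Q'g+R' , R'<d | w , gw≈1 = Q , R , a∷f≋Qg+R , R<d
    where
    R₁ : Pol
    R₁ = a ∷ R'
    c : Carrier
    c = coeff R₁ d * w
    Q : Pol
    Q = (0# ∷ Q') +ₚ const c
    R : Pol
    R = R₁ +ₚ -ₚ (const c *ₚ g)
    a∷f≋Qg+R : a ∷ f ≋ Q *ₚ g +ₚ R
    a∷f≋Qg+R = ≋R.begin
      a ∷ f                                              ≋R.≈⟨ mk≋ (∷-cong (sym (+-identityˡ a)) f≋Q'g+R') ⟩
      (0# ∷ Q' *ₚ g) +ₚ R₁                                ≋R.≈⟨ +ₚ-congʳ R₁ {0# ∷ Q' *ₚ g} (Pₚ.sym (mk≋ (X*ₚ Q' g))) ⟩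
      (0# ∷ Q') *ₚ g +ₚ R₁                                ≋R.≈⟨ x+y≋[x+z]+[y-z] ((0# ∷ Q') *ₚ g) R₁ (const c *ₚ g) ⟩
      ((0# ∷ Q') *ₚ g +ₚ const c *ₚ g) +ₚ R              ≋R.≈⟨ +ₚ-congʳ R (Pₚ.sym (Pₚ.distribʳ g (0# ∷ Q') (const c))) ⟩
      Q *ₚ g +ₚ R                                         ≋R.∎
    coeff-cg : ∀ i → coeff (-ₚ (const c *ₚ g)) i ≈ - (c * coeff g i)
    coeff-cg i = trans (coeff-neg (const c *ₚ g) i) (-‿cong (trans (const-*ₚ c g i) (coeff-scale c g i)))
    R<d : Bounded R d
    R<d i d≤i with ℕP.m≤n⇒m<n∨m≡n d≤i
    ... | inj₂ ≡.refl = begin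
        coeff R d                                ≈⟨ coeff-+ R₁ (-ₚ (const c *ₚ g)) d ⟩
        coeff R₁ d + coeff (-ₚ (const c *ₚ g)) d ≈⟨ +-congˡ (coeff-cg d) ⟩
        coeff R₁ d + - ((coeff R₁ d * w) * coeff g d)
          ≈⟨ +-congˡ (-‿cong (trans (*-assoc _ _ _) (trans (*-congˡ (trans (*-comm _ _) gw≈1)) (*-identityʳ _)))) ⟩
        coeff R₁ d + - coeff R₁ d                ≈⟨ -‿inverseʳ _ ⟩
        0#                                       ∎
    ... | inj₁ d<i = begin
        coeff R i                                ≈⟨ coeff-+ R₁ (-ₚ (const c *ₚ g)) i ⟩
        coeff R₁ i + coeff (-ₚ (const c *ₚ g)) i ≈⟨ +-cong (R₁-above i d<i) (coeff-cg i) ⟩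
        0# + - (c * coeff g i)                   ≈⟨ +-congˡ (-‿cong (trans (*-congˡ (g-above i d<i)) (zeroʳ c))) ⟩
        0# + - 0#                                ≈⟨ trans (+-identityˡ _) -0#≈0# ⟩
        0#                                       ∎
      where
      R₁-above : ∀ i → d < i → coeff R₁ i ≈ 0#
      R₁-above (suc i) (s≤s d≤i) = R'<d i d≤i

  coeff-drop1 : ∀ p i → coeff (List.drop 1 p) i ≈ coeff p (suc i)
  coeff-drop1 []      i = refl
  coeff-drop1 (a ∷ p) i = refl

  ≋X*ₚ-drop1 : ∀ p → coeff p 0 ≈ 0# → p ≋ Xₚ *ₚ List.drop 1 p
  ≋X*ₚ-drop1 p p₀≈0 = mk≋ λ i → trans (pointwise p p₀≈0 i) (sym (X*ₚ-as-shift i))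
    where
    X*ₚ-as-shift : Xₚ *ₚ List.drop 1 p ≈ₚ 0# ∷ List.drop 1 p
    X*ₚ-as-shift i = trans (X*ₚ 1ₚ (List.drop 1 p) i) (∷-cong {p = 1ₚ *ₚ List.drop 1 p} refl (mk≋ (*ₚ-identityˡ (List.drop 1 p))) i)
    pointwise : ∀ p → coeff p 0 ≈ 0# → p ≈ₚ 0# ∷ List.drop 1 p
    pointwise []      _    zero    = refl
    pointwise []      _    (suc i) = refl
    pointwise (a ∷ p) a≈0 zero    = a≈0
    pointwise (a ∷ p) _    (suc i) = refl

  HasDegree-1⇒irreducible : ∀ P → HasDegree P 1 → Irreducible P
  HasDegree-1⇒irreducible P P°1 = (λ P-const → proj₁ P°1 (P-const 1 ℕP.≤-refl)) , factors
    where
    factors : ∀ f g → P ≈ₚ f *ₚ g → IsConstant f ⊎ IsConstant g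
    factors f g P≈fg with degree-factors P P°1 f g (mk≋ P≈fg)
    ... | zero  , _    , f°0 , _   , _  = inj₁ (proj₂ f°0)
    ... | suc _ , zero , _   , g°0 , _  = inj₂ (proj₂ g°0)
    ... | suc k , suc l , _  , _   , kl = ⊥-elim (ℕP.1+n≢0 (ℕP.suc-injective (≡.trans (≡.cong suc (≡.sym (ℕP.+-suc k l))) kl)))

  record BezoutDivisor (a b : Pol) : Set where
    constructor bezoutDivisor
    field
      h u v s t : Pol
      h≋ua+vb : h ≋ u *ₚ a +ₚ v *ₚ b
      a≋sh    : a ≋ s *ₚ h
      b≋th    : b ≋ t *ₚ h
      h≉0     : ¬ h ≈ₚ []

  x≋y+z⇒z≋x-y : ∀ {x} y z → x ≋ y +ₚ z → z ≋ x +ₚ -ₚ y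
  x≋y+z⇒z≋x-y {x} y z x≋y+z = ≋R.begin
      z                              ≋R.≈⟨ Pₚ.sym (Pₚ.+-identityˡ z) ⟩
      [] +ₚ z                        ≋R.≈⟨ x+y≋[x+z]+[y-z] [] z y ⟩
      ([] +ₚ y) +ₚ (z +ₚ -ₚ y)       ≋R.≈⟨ +ₚ-congʳ (z +ₚ -ₚ y) (Pₚ.+-identityˡ y) ⟩
      y +ₚ (z +ₚ -ₚ y)               ≋R.≈⟨ Pₚ.sym (Pₚ.+-assoc y z (-ₚ y)) ⟩
      (y +ₚ z) +ₚ -ₚ y               ≋R.≈⟨ +ₚ-congʳ (-ₚ y) (Pₚ.sym x≋y+z) ⟩
      x +ₚ -ₚ y                      ≋R.∎

  bezoutDivisor-step : ∀ {a b} Q R → b ≋ Q *ₚ a +ₚ R → BezoutDivisor R a → BezoutDivisor a b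
  bezoutDivisor-step {a} {b} Q R b≋Qa+R (bezoutDivisor h u v s t h≋uR+va R≋sh a≋th h≉0) =
    bezoutDivisor h (v +ₚ -ₚ (u *ₚ Q)) u t (Q *ₚ t +ₚ s) h≋[v-uQ]a+ub a≋th b≋[Qt+s]h h≉0
    where
    h≋[v-uQ]a+ub : h ≋ (v +ₚ -ₚ (u *ₚ Q)) *ₚ a +ₚ u *ₚ b
    h≋[v-uQ]a+ub = ≋R.begin
      h                                            ≋R.≈⟨ h≋uR+va ⟩
      u *ₚ R +ₚ v *ₚ a                             ≋R.≈⟨ +ₚ-congʳ (v *ₚ a) (*ₚ-congˡ u (x≋y+z⇒z≋x-y (Q *ₚ a) R b≋Qa+R)) ⟩
      u *ₚ (b +ₚ -ₚ (Q *ₚ a)) +ₚ v *ₚ a            ≋R.≈⟨ +ₚ-congʳ (v *ₚ a) (*ₚ-congˡ u (+ₚ-congˡ b (Pₚ-Properties.-‿distribˡ-* Q a))) ⟩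
      u *ₚ (b +ₚ (-ₚ Q) *ₚ a) +ₚ v *ₚ a
        ≋R.≈⟨ solveₚ 5 (λ u b q a v → u :*ₚ (b :+ₚ q :*ₚ a) :+ₚ v :*ₚ a :=ₚ (v :+ₚ u :*ₚ q) :*ₚ a :+ₚ u :*ₚ b) Pₚ.refl u b (-ₚ Q) a v ⟩
      (v +ₚ u *ₚ (-ₚ Q)) *ₚ a +ₚ u *ₚ b            ≋R.≈⟨ +ₚ-congʳ (u *ₚ b) (*ₚ-congʳ a (+ₚ-congˡ v (Pₚ.sym (Pₚ-Properties.-‿distribʳ-* u Q)))) ⟩
      (v +ₚ -ₚ (u *ₚ Q)) *ₚ a +ₚ u *ₚ b            ≋R.∎
    b≋[Qt+s]h : b ≋ (Q *ₚ t +ₚ s) *ₚ h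
    b≋[Qt+s]h = ≋R.begin
      b                            ≋R.≈⟨ b≋Qa+R ⟩
      Q *ₚ a +ₚ R                  ≋R.≈⟨ +ₚ-cong (*ₚ-congˡ Q a≋th) R≋sh ⟩
      Q *ₚ (t *ₚ h) +ₚ s *ₚ h      ≋R.≈⟨ solveₚ 4 (λ Q t h s → Q :*ₚ (t :*ₚ h) :+ₚ s :*ₚ h :=ₚ (Q :*ₚ t :+ₚ s) :*ₚ h) Pₚ.refl Q t h s ⟩
      (Q *ₚ t +ₚ s) *ₚ h           ≋R.∎

  -- Euclid's algorithm; N bounds the degree of a so that the recursion is structural.
  bezout-bounded : ∀ N a {d} → d < N → HasDegree a d → ∀ b → BezoutDivisor a b
  bezout-bounded (suc N) a {d} (s≤s d≤N) a°d b with divMod a a°d b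
  ... | Q , R , b≋Qa+R , R<d with ≈ₚ[]? R
  ...   | yes R≈0 = bezoutDivisor a 1ₚ [] 1ₚ Q a≋1a+0b (Pₚ.sym (Pₚ.*-identityˡ a)) b≋Qa (HasDegree⇒≉[] a a°d)
    where
    a≋1a+0b : a ≋ 1ₚ *ₚ a +ₚ [] *ₚ b
    a≋1a+0b = Pₚ.sym (Pₚ.trans (Pₚ.+-identityʳ _) (Pₚ.*-identityˡ a))
    b≋Qa : b ≋ Q *ₚ a
    b≋Qa = Pₚ.trans b≋Qa+R (Pₚ.trans (+ₚ-congˡ (Q *ₚ a) (mk≋ R≈0)) (Pₚ.+-identityʳ _))
  ...   | no R≉0 with degree R R≉0
  ...     | k , R°k = bezoutDivisor-step Q R b≋Qa+R (bezout-bounded N R (ℕP.<-≤-trans k<d d≤N) R°k a)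
    where
    k<d : k < d
    k<d with k ℕ.<? d
    ... | yes k<d = k<d
    ... | no k≮d  = ⊥-elim (proj₁ R°k (R<d k (ℕP.≮⇒≥ k≮d)))

  bezout : ∀ a b → ¬ a ≈ₚ [] → BezoutDivisor a b
  bezout a b a≉0 with degree a a≉0
  ... | d , a°d = bezout-bounded (suc d) a ℕP.≤-refl a°d b

  Coprime : Pol → Pol → Set
  Coprime a b = ∃₂ λ u v → 1ₚ ≋ u *ₚ a +ₚ v *ₚ b

  nonzeroConstant⇒unit : ∀ p → IsConstant p → ¬ p ≈ₚ [] → ∃ λ w → w *ₚ p ≋ 1ₚ
  nonzeroConstant⇒unit p p-const p≉0 with const-inverse p₀≉0
    where
    p₀≉0 : ¬ coeff p 0 ≈ 0#
    p₀≉0 p₀≈0 = p≉0 (λ { zero → p₀≈0 ; (suc i) → p-const (suc i) (s≤s z≤n) })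
  ... | w , w*p₀≋1 = const w , Pₚ.trans (*ₚ-congˡ (const w) (IsConstant⇒≋const p p-const)) w*p₀≋1

  irreducible⇒≉[] : ∀ C → Irreducible C → ¬ C ≈ₚ []
  irreducible⇒≉[] C (C-nonconst , _) C≈0 = C-nonconst (λ i _ → C≈0 i)

  -- The Bézout divisor h of C and g divides C, so it is a unit or an associate of C.
  irreducible⇒∣⊎coprime : ∀ C → Irreducible C → ∀ g → C ∣ₚ g ⊎ Coprime C g
  irreducible⇒∣⊎coprime C C-irr g with bezout C g (irreducible⇒≉[] C C-irr)
  ... | bezoutDivisor h u v s t h≋uC+vg C≋sh g≋th h≉0 with proj₂ C-irr s h (un≋ C≋sh)
  ...   | inj₂ h-const with nonzeroConstant⇒unit h h-const h≉0
  ...     | w , wh≋1 = inj₂ (w *ₚ u , w *ₚ v , (≋R.begin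
      1ₚ                                   ≋R.≈⟨ Pₚ.sym wh≋1 ⟩
      w *ₚ h                               ≋R.≈⟨ *ₚ-congˡ w h≋uC+vg ⟩
      w *ₚ (u *ₚ C +ₚ v *ₚ g)              ≋R.≈⟨ solveₚ 5 (λ w u C v g → w :*ₚ (u :*ₚ C :+ₚ v :*ₚ g) :=ₚ w :*ₚ u :*ₚ C :+ₚ w :*ₚ v :*ₚ g) Pₚ.refl w u C v g ⟩
      w *ₚ u *ₚ C +ₚ w *ₚ v *ₚ g           ≋R.∎))
  irreducible⇒∣⊎coprime C C-irr g
      | bezoutDivisor h u v s t h≋uC+vg C≋sh g≋th h≉0 | inj₁ s-const with nonzeroConstant⇒unit s s-const s≉0
    where
    s≉0 : ¬ s ≈ₚ []
    s≉0 s≈0 = irreducible⇒≉[] C C-irr (λ i → trans (un≋ C≋sh i) (*ₚ-zeroˡ s h s≈0 i))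
  ...     | w , ws≋1 = inj₁ (t *ₚ w , (≋R.begin
      g                         ≋R.≈⟨ g≋th ⟩
      t *ₚ h                    ≋R.≈⟨ *ₚ-congˡ t (Pₚ.sym (Pₚ.*-identityˡ h)) ⟩
      t *ₚ (1ₚ *ₚ h)            ≋R.≈⟨ *ₚ-congˡ t (*ₚ-congʳ h (Pₚ.sym ws≋1)) ⟩
      t *ₚ ((w *ₚ s) *ₚ h)      ≋R.≈⟨ *ₚ-congˡ t (Pₚ.*-assoc w s h) ⟩
      t *ₚ (w *ₚ (s *ₚ h))      ≋R.≈⟨ *ₚ-congˡ t (*ₚ-congˡ w (Pₚ.sym C≋sh)) ⟩
      t *ₚ (w *ₚ C)             ≋R.≈⟨ solveₚ 3 (λ t w C → t :*ₚ (w :*ₚ C) :=ₚ C :*ₚ (t :*ₚ w)) Pₚ.refl t w C ⟩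
      C *ₚ (t *ₚ w)             ≋R.∎))

  irreducible⇒prime : ∀ C → Irreducible C → ∀ f g → C ∣ₚ f *ₚ g → C ∣ₚ f ⊎ C ∣ₚ g
  irreducible⇒prime C C-irr f g (K , fg≋CK) with irreducible⇒∣⊎coprime C C-irr f
  ... | inj₁ C∣f = inj₁ C∣f
  ... | inj₂ (u , v , 1≋uC+vf) = inj₂ (u *ₚ g +ₚ v *ₚ K , (≋R.begin
      g                                   ≋R.≈⟨ Pₚ.sym (Pₚ.*-identityˡ g) ⟩
      1ₚ *ₚ g                             ≋R.≈⟨ *ₚ-congʳ g 1≋uC+vf ⟩
      (u *ₚ C +ₚ v *ₚ f) *ₚ g             ≋R.≈⟨ solveₚ 5 (λ u C v f g → (u :*ₚ C :+ₚ v :*ₚ f) :*ₚ g :=ₚ u :*ₚ C :*ₚ g :+ₚ v :*ₚ (f :*ₚ g)) Pₚ.refl u C v f g ⟩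
      u *ₚ C *ₚ g +ₚ v *ₚ (f *ₚ g)        ≋R.≈⟨ +ₚ-congˡ (u *ₚ C *ₚ g) (*ₚ-congˡ v fg≋CK) ⟩
      u *ₚ C *ₚ g +ₚ v *ₚ (C *ₚ K)        ≋R.≈⟨ solveₚ 5 (λ u C v K g → u :*ₚ C :*ₚ g :+ₚ v :*ₚ (C :*ₚ K) :=ₚ C :*ₚ (u :*ₚ g :+ₚ v :*ₚ K)) Pₚ.refl u C v K g ⟩
      C *ₚ (u *ₚ g +ₚ v *ₚ K)             ≋R.∎))

  coprime⇒*ₚ-∣ : ∀ C D h → Coprime C D → C ∣ₚ h → D ∣ₚ h → C *ₚ D ∣ₚ h
  coprime⇒*ₚ-∣ C D h (u , v , 1≋uC+vD) (K , h≋CK) (L , h≋DL) = u *ₚ L +ₚ v *ₚ K , (≋R.begin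
      h                                         ≋R.≈⟨ h≋CK ⟩
      C *ₚ K                                    ≋R.≈⟨ *ₚ-congˡ C (Pₚ.sym (Pₚ.*-identityˡ K)) ⟩
      C *ₚ (1ₚ *ₚ K)                            ≋R.≈⟨ *ₚ-congˡ C (*ₚ-congʳ K 1≋uC+vD) ⟩
      C *ₚ ((u *ₚ C +ₚ v *ₚ D) *ₚ K)            ≋R.≈⟨ solveₚ 5 (λ C u v D K → C :*ₚ ((u :*ₚ C :+ₚ v :*ₚ D) :*ₚ K) :=ₚ C :*ₚ (u :*ₚ (C :*ₚ K) :+ₚ v :*ₚ D :*ₚ K)) Pₚ.refl C u v D K ⟩
      C *ₚ (u *ₚ (C *ₚ K) +ₚ v *ₚ D *ₚ K)       ≋R.≈⟨ *ₚ-congˡ C (+ₚ-congʳ (v *ₚ D *ₚ K) (*ₚ-congˡ u (Pₚ.trans (Pₚ.sym h≋CK) h≋DL))) ⟩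
      C *ₚ (u *ₚ (D *ₚ L) +ₚ v *ₚ D *ₚ K)       ≋R.≈⟨ solveₚ 6 (λ C u D L v K → C :*ₚ (u :*ₚ (D :*ₚ L) :+ₚ v :*ₚ D :*ₚ K) :=ₚ C :*ₚ D :*ₚ (u :*ₚ L :+ₚ v :*ₚ K)) Pₚ.refl C u D L v K ⟩
      C *ₚ D *ₚ (u *ₚ L +ₚ v *ₚ K)              ≋R.∎)

module Substitutions {q : ℕ} (F : FiniteField q) where
  open Division F public

  subSq-+ₚ : ∀ p r → subSq (p +ₚ r) ≋ subSq p +ₚ subSq r
  subSq-+ₚ []      r       = Pₚ.refl
  subSq-+ₚ (a ∷ p) []      = Pₚ.refl
  subSq-+ₚ (a ∷ p) (b ∷ r) = mk≋ (∷-cong refl (mk≋ (∷-cong (sym (+-identityˡ 0#)) (subSq-+ₚ p r))))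

  subSq-scale : ∀ c p → subSq (scale c p) ≋ scale c (subSq p)
  subSq-scale c []      = Pₚ.refl
  subSq-scale c (a ∷ p) = mk≋ (∷-cong refl (mk≋ (∷-cong (sym (zeroʳ c)) (subSq-scale c p))))

  subSq-cong : ∀ {p r} → p ≋ r → subSq p ≋ subSq r
  subSq-cong {p} {r} (mk≋ p≈r) = mk≋ λ i → pointwise i
    where
    pointwise : ∀ i → coeff (subSq p) i ≈ coeff (subSq r) i
    pointwise i with even⊎odd i
    ... | j , inj₁ ≡.refl = trans (coeff-subSq-double p j) (trans (p≈r j) (sym (coeff-subSq-double r j)))
    ... | j , inj₂ ≡.refl = trans (coeff-subSq-suc-double p j) (sym (coeff-subSq-suc-double r j))

  subSq-*ₚ : ∀ p r → subSq (p *ₚ r) ≋ subSq p *ₚ subSq r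
  subSq-*ₚ []      r = Pₚ.refl
  subSq-*ₚ (a ∷ p) r = ≋R.begin
      subSq (scale a r +ₚ (0# ∷ p *ₚ r))                ≋R.≈⟨ subSq-+ₚ (scale a r) (0# ∷ p *ₚ r) ⟩
      subSq (scale a r) +ₚ (0# ∷ 0# ∷ subSq (p *ₚ r))   ≋R.≈⟨ +ₚ-cong (subSq-scale a r) (mk≋ (∷-cong refl (mk≋ (∷-cong refl (subSq-*ₚ p r))))) ⟩
      scale a (subSq r) +ₚ (0# ∷ 0# ∷ subSq p *ₚ subSq r)
        ≋R.≈⟨ +ₚ-congˡ (scale a (subSq r)) (mk≋ (∷-cong refl (Pₚ.sym (mk≋ (X*ₚ (subSq p) (subSq r)))))) ⟩
      scale a (subSq r) +ₚ (0# ∷ (0# ∷ subSq p) *ₚ subSq r) ≋R.∎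

  subSq-injective : ∀ {p r} → subSq p ≋ subSq r → p ≋ r
  subSq-injective {p} {r} (mk≋ e) =
    mk≋ (λ j → trans (sym (coeff-subSq-double p j)) (trans (e (double j)) (coeff-subSq-double r j)))

  HasDegree-subSq : ∀ f {k} → HasDegree f k → HasDegree (subSq f) (double k)
  HasDegree-subSq f {k} (top≉0 , above≈0) = (λ top≈0 → top≉0 (trans (sym (coeff-subSq-double f k)) top≈0)) , above
    where
    above : ∀ i → double k < i → coeff (subSq f) i ≈ 0#
    above i k<i with even⊎odd i
    ... | j , inj₁ ≡.refl = trans (coeff-subSq-double f j) (above≈0 j (double-cancel-< k<i))
    ... | j , inj₂ ≡.refl = coeff-subSq-suc-double f j

  negVar-cong : ∀ {p r} → p ≋ r → negVar p ≋ negVar r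
  negVar-cong {p} {r} (mk≋ p≈r) = mk≋ (λ i → trans (coeff-negVar p i) (trans (*-congˡ (p≈r i)) (sym (coeff-negVar r i))))

  negVar-*ₚ : ∀ p r → negVar (p *ₚ r) ≋ negVar p *ₚ negVar r
  negVar-*ₚ p r = mk≋ λ k → begin
      coeff (negVar (p *ₚ r)) k                                 ≈⟨ coeff-negVar (p *ₚ r) k ⟩
      sign k * coeff (p *ₚ r) k                                 ≈⟨ *-congˡ (coeff-* p r k) ⟩
      sign k * convolution p r k                                ≈⟨ sym (sumTo-*ˡ (sign k) _ k) ⟩
      sumTo (λ u → sign k * (coeff p u * coeff r (k ℕ.∸ u))) k  ≈⟨ sumTo-cong k (term k) ⟩
      convolution (negVar p) (negVar r) k                       ≈⟨ sym (coeff-* (negVar p) (negVar r) k) ⟩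
      coeff (negVar p *ₚ negVar r) k                            ∎
    where
    term : ∀ k u → u ≤ k → sign k * (coeff p u * coeff r (k ℕ.∸ u)) ≈ coeff (negVar p) u * coeff (negVar r) (k ℕ.∸ u)
    term k u u≤k = begin
      sign k * (coeff p u * coeff r (k ℕ.∸ u))
        ≈⟨ *-congʳ (≡.subst (λ x → sign x ≈ sign (u ℕ.+ (k ℕ.∸ u))) (ℕP.m+[n∸m]≡n u≤k) refl) ⟩
      sign (u ℕ.+ (k ℕ.∸ u)) * (coeff p u * coeff r (k ℕ.∸ u))
        ≈⟨ *-congʳ (sign-+ u (k ℕ.∸ u)) ⟩
      (sign u * sign (k ℕ.∸ u)) * (coeff p u * coeff r (k ℕ.∸ u))
        ≈⟨ solve 4 (λ a b c d → (a :* b) :* (c :* d) := (a :* c) :* (b :* d)) refl (sign u) (sign (k ℕ.∸ u)) (coeff p u) (coeff r (k ℕ.∸ u)) ⟩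
      (sign u * coeff p u) * (sign (k ℕ.∸ u) * coeff r (k ℕ.∸ u))
        ≈⟨ sym (*-cong (coeff-negVar p u) (coeff-negVar r (k ℕ.∸ u))) ⟩
      coeff (negVar p) u * coeff (negVar r) (k ℕ.∸ u) ∎

  negVar-subSq : ∀ f → negVar (subSq f) ≋ subSq f
  negVar-subSq f = mk≋ λ i → trans (coeff-negVar (subSq f) i) (even-coefficients i)
    where
    even-coefficients : ∀ i → sign i * coeff (subSq f) i ≈ coeff (subSq f) i
    even-coefficients i with even⊎odd i
    ... | j , inj₁ ≡.refl = trans (*-congʳ (sign-double j)) (*-identityˡ _)
    ... | j , inj₂ ≡.refl = trans (*-congˡ (coeff-subSq-suc-double f j)) (trans (zeroʳ _) (sym (coeff-subSq-suc-double f j)))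

  HasDegree-negVar : ∀ f {k} → HasDegree f k → HasDegree (negVar f) k
  HasDegree-negVar f {k} (top≉0 , above≈0) =
    (λ top≈0 → x≉0∧y≉0⇒x*y≉0 (sign≉0 k) top≉0 (trans (sym (coeff-negVar f k)) top≈0)) ,
    (λ i k<i → trans (coeff-negVar f i) (trans (*-congˡ (above≈0 i k<i)) (zeroʳ _)))

  evenPart : Pol → Pol
  evenPart []          = []
  evenPart (a ∷ [])    = a ∷ []
  evenPart (a ∷ b ∷ p) = a ∷ evenPart p

  coeff-evenPart : ∀ p j → coeff (evenPart p) j ≈ coeff p (double j)
  coeff-evenPart []          j       = refl
  coeff-evenPart (a ∷ [])    zero    = refl
  coeff-evenPart (a ∷ [])    (suc j) = refl
  coeff-evenPart (a ∷ b ∷ p) zero    = refl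
  coeff-evenPart (a ∷ b ∷ p) (suc j) = coeff-evenPart p j

  oddCoefficients≈0⇒≋subSq-evenPart : ∀ p → (∀ j → coeff p (suc (double j)) ≈ 0#) → p ≋ subSq (evenPart p)
  oddCoefficients≈0⇒≋subSq-evenPart p odd≈0 = mk≋ λ i → pointwise i
    where
    pointwise : ∀ i → coeff p i ≈ coeff (subSq (evenPart p)) i
    pointwise i with even⊎odd i
    ... | j , inj₁ ≡.refl = sym (trans (coeff-subSq-double (evenPart p) j) (coeff-evenPart p j))
    ... | j , inj₂ ≡.refl = trans (odd≈0 j) (sym (coeff-subSq-suc-double (evenPart p) j))

  coeff-*ₚ-negVar : ∀ p k → coeff (p *ₚ negVar p) k ≈ sumTo (λ u → sign (k ℕ.∸ u) * (coeff p u * coeff p (k ℕ.∸ u))) k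
  coeff-*ₚ-negVar p k = trans (coeff-* p (negVar p) k) (sumTo-cong k (λ u _ → trans (*-congˡ (coeff-negVar p (k ℕ.∸ u)))
    (solve 3 (λ a s b → a :* (s :* b) := s :* (a :* b)) refl (coeff p u) (sign (k ℕ.∸ u)) (coeff p (k ℕ.∸ u)))))

  coeff-*ₚ-negVar-double : ∀ p j →
    coeff (p *ₚ negVar p) (double j) ≈ sumTo (λ u → sign u * (coeff p u * coeff p (double j ℕ.∸ u))) (double j)
  coeff-*ₚ-negVar-double p j = trans (coeff-*ₚ-negVar p (double j)) (sumTo-cong (double j) (λ u u≤ → *-congʳ (begin
      sign (double j ℕ.∸ u)      ≈⟨ sign-∸ u≤ ⟩
      sign (double j) * sign u   ≈⟨ *-congʳ (sign-double j) ⟩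
      1# * sign u                ≈⟨ *-identityˡ _ ⟩
      sign u                     ∎)))

  -- The summand at u is the negative of the summand at k - u when k is odd.
  coeff-*ₚ-negVar-suc-double : CharacteristicNot2 F → ∀ p j → coeff (p *ₚ negVar p) (suc (double j)) ≈ 0#
  coeff-*ₚ-negVar-suc-double 1+1≉0 p j = trans (coeff-*ₚ-negVar p k) (x≈-x⇒x≈0 1+1≉0 (sumTo T k) (begin
      sumTo T k                      ≈⟨ sumTo-reverse T k ⟩
      sumTo (λ u → T (k ℕ.∸ u)) k    ≈⟨ sumTo-cong k T-antisymmetric ⟩
      sumTo (λ u → - T u) k          ≈⟨ sumTo-neg T k ⟩
      - sumTo T k                    ∎))
    where
    k : ℕ
    k = suc (double j)
    c : ℕ → Carrier
    c = coeff p
    T : ℕ → Carrier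
    T u = sign (k ℕ.∸ u) * (c u * c (k ℕ.∸ u))
    T-antisymmetric : ∀ u → u ≤ k → T (k ℕ.∸ u) ≈ - T u
    T-antisymmetric u u≤k = begin
      sign (k ℕ.∸ (k ℕ.∸ u)) * (c (k ℕ.∸ u) * c (k ℕ.∸ (k ℕ.∸ u)))
        ≈⟨ ≡.subst (λ x → sign x * (c (k ℕ.∸ u) * c x) ≈ sign u * (c (k ℕ.∸ u) * c u)) (≡.sym (ℕP.m∸[m∸n]≡n u≤k)) refl ⟩
      sign u * (c (k ℕ.∸ u) * c u)                 ≈⟨ *-cong (sym (*-identityˡ _)) (*-comm _ _) ⟩
      1# * sign u * (c u * c (k ℕ.∸ u))            ≈⟨ *-congʳ (*-congʳ (sym (-‿involutive 1#))) ⟩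
      - - 1# * sign u * (c u * c (k ℕ.∸ u))        ≈⟨ *-congʳ (*-congʳ (-‿cong (-‿cong (sym (sign-double j))))) ⟩
      - sign k * sign u * (c u * c (k ℕ.∸ u))      ≈⟨ *-congʳ (sym (-‿distribˡ-* _ _)) ⟩
      - (sign k * sign u) * (c u * c (k ℕ.∸ u))    ≈⟨ *-congʳ (-‿cong (sym (sign-∸ u≤k))) ⟩
      - sign (k ℕ.∸ u) * (c u * c (k ℕ.∸ u))       ≈⟨ sym (-‿distribˡ-* _ _) ⟩
      - T u                                        ∎

  private
    coeff-map-applyUpTo-< : ∀ (f : ℕ → Carrier) g m j → j < m → coeff (List.map f (List.applyUpTo g m)) j ≡ f (g j)
    coeff-map-applyUpTo-< f g (suc m) zero    _          = ≡.refl
    coeff-map-applyUpTo-< f g (suc m) (suc j) (s≤s j<m) = coeff-map-applyUpTo-< f (λ x → g (suc x)) m j j<m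

    coeff-map-applyUpTo-≥ : ∀ (f : ℕ → Carrier) g m j → m ≤ j → coeff (List.map f (List.applyUpTo g m)) j ≡ 0#
    coeff-map-applyUpTo-≥ f g zero    j       _          = ≡.refl
    coeff-map-applyUpTo-≥ f g (suc m) (suc j) (s≤s m≤j) = coeff-map-applyUpTo-≥ f (λ x → g (suc x)) m j m≤j

  coeff-fromCoeffs-≤ : ∀ f n j → j ≤ n → coeff (fromCoeffs f n) j ≈ f j
  coeff-fromCoeffs-≤ f n j j≤n = reflexive (coeff-map-applyUpTo-< f (λ x → x) (suc n) j (s≤s j≤n))

  coeff-fromCoeffs-> : ∀ f n j → n < j → coeff (fromCoeffs f n) j ≈ 0#
  coeff-fromCoeffs-> f n j n<j = reflexive (coeff-map-applyUpTo-≥ f (λ x → x) (suc n) j n<j)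

module ProductWithReflection {q : ℕ} (F : FiniteField q) (1+1≉0 : CharacteristicNot2 F)
         (C : Poly.Pol F) {n : ℕ} (C-monic : Poly.MonicOfDegree F C n) where
  open Substitutions F public

  A : Pol
  A = Apoly C n

  C⁻ : Pol
  C⁻ = scale (sign n) (negVar C)

  c : ℕ → Carrier
  c = coeff C

  cₙ≈1 : c n ≈ 1#
  cₙ≈1 = proj₁ C-monic

  C-bounded : Bounded C (suc n)
  C-bounded = proj₂ C-monic

  HasDegree-C : HasDegree C n
  HasDegree-C = (λ cₙ≈0 → 1≉0 (trans (sym cₙ≈1) cₙ≈0)) , C-bounded

  coeff-C⁻ : ∀ i → coeff C⁻ i ≈ sign n * (sign i * c i)
  coeff-C⁻ i = trans (coeff-scale (sign n) (negVar C) i) (*-congˡ (coeff-negVar C i))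

  coeff-C*C⁻ : ∀ k → coeff (C *ₚ C⁻) k ≈ sign n * coeff (C *ₚ negVar C) k
  coeff-C*C⁻ k = begin
      coeff (C *ₚ C⁻) k                     ≈⟨ *ₚ-comm C C⁻ k ⟩
      coeff (C⁻ *ₚ C) k                     ≈⟨ scale-*ₚ (sign n) (negVar C) C k ⟩
      coeff (scale (sign n) (negVar C *ₚ C)) k ≈⟨ coeff-scale (sign n) (negVar C *ₚ C) k ⟩
      sign n * coeff (negVar C *ₚ C) k      ≈⟨ *-congˡ (*ₚ-comm (negVar C) C k) ⟩
      sign n * coeff (C *ₚ negVar C) k      ∎

  C*C⁻-leading : coeff (C *ₚ C⁻) (n ℕ.+ n) ≈ c n * coeff C⁻ n × Bounded (C *ₚ C⁻) (suc (n ℕ.+ n))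
  C*C⁻-leading = *ₚ-leading C C⁻ n n C-bounded C⁻-bounded
    where
    C⁻-bounded : Bounded C⁻ (suc n)
    C⁻-bounded i n<i = trans (coeff-C⁻ i) (trans (*-congˡ (trans (*-congˡ (C-bounded i n<i)) (zeroʳ _))) (zeroʳ _))

  C*C⁻≈subSq-A : C *ₚ C⁻ ≈ₚ subSq A
  C*C⁻≈subSq-A k with even⊎odd k
  ... | j , inj₂ ≡.refl = begin
      coeff (C *ₚ C⁻) (suc (double j))                 ≈⟨ coeff-C*C⁻ _ ⟩
      sign n * coeff (C *ₚ negVar C) (suc (double j))  ≈⟨ *-congˡ (coeff-*ₚ-negVar-suc-double 1+1≉0 C j) ⟩
      sign n * 0#                                      ≈⟨ zeroʳ _ ⟩
      0#                                               ≈⟨ sym (coeff-subSq-suc-double A j) ⟩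
      coeff (subSq A) (suc (double j))                 ∎
  ... | j , inj₁ ≡.refl with j ℕ.≤? n
  ...   | yes j≤n = begin
      coeff (C *ₚ C⁻) (double j)                                              ≈⟨ coeff-C*C⁻ _ ⟩
      sign n * coeff (C *ₚ negVar C) (double j)                               ≈⟨ *-congˡ (coeff-*ₚ-negVar-double C j) ⟩
      sign n * sumTo (λ u → sign u * (c u * c (double j ℕ.∸ u))) (double j)
        ≡⟨ ≡.cong (λ m → sign n * sumTo (λ u → sign u * (c u * c (m ℕ.∸ u))) m) (double≡2* j) ⟩
      sign n * sumTo (λ u → sign u * (c u * c (2 ℕ.* j ℕ.∸ u))) (2 ℕ.* j)    ≈⟨ sym (coeff-fromCoeffs-≤ _ n j j≤n) ⟩
      coeff A j                                                               ≈⟨ sym (coeff-subSq-double A j) ⟩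
      coeff (subSq A) (double j)                                              ∎
  ...   | no j≰n = begin
      coeff (C *ₚ C⁻) (double j)   ≈⟨ proj₂ C*C⁻-leading (double j) 2n<2j ⟩
      0#                           ≈⟨ sym (coeff-fromCoeffs-> _ n j n<j) ⟩
      coeff A j                    ≈⟨ sym (coeff-subSq-double A j) ⟩
      coeff (subSq A) (double j)   ∎
    where
    n<j : n < j
    n<j = ℕP.≰⇒> j≰n
    2n<2j : suc (n ℕ.+ n) ≤ double j
    2n<2j = ≡.subst (n ℕ.+ n <_) (≡.sym (double≡+ j)) (ℕP.+-mono-< n<j n<j)

  C*C⁻≋subSq-A : C *ₚ C⁻ ≋ subSq A
  C*C⁻≋subSq-A = mk≋ C*C⁻≈subSq-A

  A-monic : MonicOfDegree A n
  A-monic = Aₙ≈1 , coeff-fromCoeffs-> _ n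
    where
    Aₙ≈1 : coeff A n ≈ 1#
    Aₙ≈1 = begin
      coeff A n                        ≈⟨ sym (coeff-subSq-double A n) ⟩
      coeff (subSq A) (double n)       ≈⟨ sym (C*C⁻≈subSq-A (double n)) ⟩
      coeff (C *ₚ C⁻) (double n)       ≡⟨ ≡.cong (coeff (C *ₚ C⁻)) (double≡+ n) ⟩
      coeff (C *ₚ C⁻) (n ℕ.+ n)        ≈⟨ proj₁ C*C⁻-leading ⟩
      c n * coeff C⁻ n                 ≈⟨ *-cong cₙ≈1 (coeff-C⁻ n) ⟩
      1# * (sign n * (sign n * c n))   ≈⟨ trans (*-identityˡ _) (*-congˡ (*-congˡ cₙ≈1)) ⟩
      sign n * (sign n * 1#)           ≈⟨ trans (*-congˡ (*-identityʳ _)) (sign²≈1 n) ⟩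
      1#                               ∎

  HasDegree-A : HasDegree A n
  HasDegree-A = (λ Aₙ≈0 → 1≉0 (trans (sym (proj₁ A-monic)) Aₙ≈0)) , proj₂ A-monic

module IrreducibilityCriterion {q : ℕ} (F : FiniteField q) (1+1≉0 : CharacteristicNot2 F)
         (C : Poly.Pol F) {n : ℕ} (C-monic : Poly.MonicOfDegree F C n) (1≤n : 1 ≤ n) (C-irr : Poly.Irreducible F C) where
  open ProductWithReflection F 1+1≉0 C C-monic public

  OddCoefficient : Set
  OddCoefficient = ∃ λ i → i % 2 ≡ 1 × 1 ≤ i × i ≤ n × ¬ c i ≈ 0#

  -- If c₀ = 0 then X divides C, so C is X up to a unit.
  c₀≈0⇒n≡1 : c 0 ≈ 0# → n ≡ 1
  c₀≈0⇒n≡1 c₀≈0 with proj₂ C-irr Xₚ (List.drop 1 C) (un≋ (≋X*ₚ-drop1 C c₀≈0))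
  ... | inj₁ X-const = ⊥-elim (1≉0 (X-const 1 ℕP.≤-refl))
  ... | inj₂ T-const = leading-index n 1≤n cₙ≈1
    where
    leading-index : ∀ m → 1 ≤ m → c m ≈ 1# → m ≡ 1
    leading-index (suc zero)    _ _    = ≡.refl
    leading-index (suc (suc m)) _ cₘ≈1 = ⊥-elim (1≉0 (trans (sym cₘ≈1) (trans (sym (coeff-drop1 C (suc m))) (T-const (suc m) (s≤s z≤n)))))

  -- If C ∣ C(-X), comparing degrees and constant terms gives C(-X) = C, killing the odd coefficients.
  oddCoefficient⇒coprime : OddCoefficient → ¬ c 0 ≈ 0# → Coprime C (negVar C)
  oddCoefficient⇒coprime (i , i-odd , _ , _ , cᵢ≉0) c₀≉0 with irreducible⇒∣⊎coprime C C-irr (negVar C)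
  ... | inj₂ coprime = coprime
  ... | inj₁ (s , C[-X]≋Cs) with degree-factors (negVar C) (HasDegree-negVar C HasDegree-C) C s C[-X]≋Cs
  ...   | k , l , C°k , s°l , k+l≡n = ⊥-elim (cᵢ≉0 cᵢ≈0)
    where
    l≡0 : l ≡ 0
    l≡0 = ℕP.+-cancelˡ-≡ n l 0 (≡.trans (≡.cong (ℕ._+ l) (HasDegree-unique C HasDegree-C C°k)) (≡.trans k+l≡n (≡.sym (ℕP.+-identityʳ n))))
    σ : Carrier
    σ = coeff s 0
    sign*c≈σ*c : ∀ k → sign k * c k ≈ σ * c k
    sign*c≈σ*c k = begin
      sign k * c k                  ≈⟨ sym (coeff-negVar C k) ⟩
      coeff (negVar C) k            ≈⟨ un≋ C[-X]≋Cs k ⟩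
      coeff (C *ₚ s) k              ≈⟨ *ₚ-comm C s k ⟩
      coeff (s *ₚ C) k              ≈⟨ un≋ (*ₚ-congʳ C (IsConstant⇒≋const s (proj₂ (≡.subst (HasDegree s) l≡0 s°l)))) k ⟩
      coeff (const σ *ₚ C) k        ≈⟨ trans (const-*ₚ σ C k) (coeff-scale σ C k) ⟩
      σ * c k                       ∎
    σ≈1 : σ ≈ 1#
    σ≈1 = sym (*-cancelˡ-nonzero c₀≉0 (trans (*-identityʳ _) (trans (sym (*-identityˡ _)) (trans (sign*c≈σ*c 0) (*-comm _ _)))))
    cᵢ≈0 : c i ≈ 0#
    cᵢ≈0 = x≈-x⇒x≈0 1+1≉0 _ (begin
      c i             ≈⟨ sym (*-identityˡ _) ⟩
      1# * c i        ≈⟨ *-congʳ (sym σ≈1) ⟩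
      σ * c i         ≈⟨ sym (sign*c≈σ*c i) ⟩
      sign i * c i    ≈⟨ *-congʳ (sign-odd i i-odd) ⟩
      - 1# * c i      ≈⟨ -1*x≈-x _ ⟩
      - c i           ∎)

  -- C ∣ f(X²) gives C(-X) ∣ f(X²) as well, so deg f(X²) ≥ 2n and g is a constant.
  coprime⇒cofactor-constant : Coprime C (negVar C) → ∀ f g → A ≋ f *ₚ g → C ∣ₚ subSq f → IsConstant g
  coprime⇒cofactor-constant coprime f g A≋fg (K , f[X²]≋CK) with degree-factors A HasDegree-A f g A≋fg
  ... | k , l , f°k , g°l , k+l≡n = proj₂ (≡.subst (HasDegree g) l≡0 g°l)
    where
    C[-X]∣f[X²] : negVar C ∣ₚ subSq f
    C[-X]∣f[X²] = negVar K , Pₚ.trans (Pₚ.sym (negVar-subSq f)) (Pₚ.trans (negVar-cong f[X²]≋CK) (negVar-*ₚ C K))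
    CC[-X]∣f[X²] : C *ₚ negVar C ∣ₚ subSq f
    CC[-X]∣f[X²] = coprime⇒*ₚ-∣ C (negVar C) (subSq f) coprime (K , f[X²]≋CK) C[-X]∣f[X²]
    M : Pol
    M = proj₁ CC[-X]∣f[X²]
    M≉0 : ¬ M ≈ₚ []
    M≉0 M≈0 = HasDegree⇒≉[] (subSq f) (HasDegree-subSq f f°k)
                (λ i → trans (un≋ (proj₂ CC[-X]∣f[X²]) i) (*ₚ-zeroʳ (C *ₚ negVar C) M M≈0 i))
    m : ℕ
    m = proj₁ (degree M M≉0)
    2k≡2n+m : double k ≡ (n ℕ.+ n) ℕ.+ m
    2k≡2n+m = HasDegree-unique (subSq f) (HasDegree-subSq f f°k)
      (HasDegree-cong (Pₚ.sym (proj₂ CC[-X]∣f[X²]))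
        (HasDegree-*ₚ (C *ₚ negVar C) M (HasDegree-*ₚ C (negVar C) HasDegree-C (HasDegree-negVar C HasDegree-C)) (proj₂ (degree M M≉0))))
    l≡0 : l ≡ 0
    l≡0 = k+l≡n∧2k≡2n+m⇒l≡0 k l m n k+l≡n 2k≡2n+m

  oddCoefficient⇒irreducible-A : OddCoefficient → Irreducible A
  oddCoefficient⇒irreducible-A odd = A-nonconstant , factors
    where
    A-nonconstant : ¬ IsConstant A
    A-nonconstant A-const = proj₁ HasDegree-A (A-const n 1≤n)
    factors : ∀ f g → A ≈ₚ f *ₚ g → IsConstant f ⊎ IsConstant g
    factors f g A≈fg with c 0 ≈? 0#
    ... | yes c₀≈0 = proj₂ (HasDegree-1⇒irreducible A (≡.subst (HasDegree A) (c₀≈0⇒n≡1 c₀≈0) HasDegree-A)) f g A≈fg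
    ... | no c₀≉0 = [ inj₂ ∘ cofactor-constant f g (mk≋ A≈fg) , inj₁ ∘ cofactor-constant g f (Pₚ.trans (mk≋ A≈fg) (Pₚ.*-comm f g)) ]′
                      (irreducible⇒prime C C-irr (subSq f) (subSq g) (C⁻ , f[X²]g[X²]≋CC⁻))
      where
      cofactor-constant : ∀ f g → A ≋ f *ₚ g → C ∣ₚ subSq f → IsConstant g
      cofactor-constant = coprime⇒cofactor-constant (oddCoefficient⇒coprime odd c₀≉0)
      f[X²]g[X²]≋CC⁻ : subSq f *ₚ subSq g ≋ C *ₚ C⁻
      f[X²]g[X²]≋CC⁻ = Pₚ.trans (Pₚ.sym (subSq-*ₚ f g)) (Pₚ.trans (subSq-cong (Pₚ.sym (mk≋ A≈fg))) (Pₚ.sym C*C⁻≋subSq-A))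

  -- Without odd terms C(X) = E(X²) with n even, so C⁻ = C and A = E².
  oddCoefficients≈0⇒reducible-A : (∀ j → c (suc (double j)) ≈ 0#) → ¬ Irreducible A
  oddCoefficients≈0⇒reducible-A odd≈0 A-irr with even⊎odd n
  ... | j , inj₂ n≡2j+1 = 1≉0 (trans (sym cₙ≈1) (≡.subst (λ i → c i ≈ 0#) (≡.sym n≡2j+1) (odd≈0 j)))
  ... | m , inj₁ n≡2m = E-nonconstant (reduce (proj₂ A-irr E E A≈E*E))
    where
    E : Pol
    E = evenPart C
    C≋E[X²] : C ≋ subSq E
    C≋E[X²] = oddCoefficients≈0⇒≋subSq-evenPart C odd≈0
    C⁻≋C : C⁻ ≋ C
    C⁻≋C = ≋R.begin
      scale (sign n) (negVar C)  ≋R.≈⟨ mk≋ (λ k → trans (coeff-scale (sign n) (negVar C) k)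
                                         (trans (*-congʳ (≡.subst (λ i → sign i ≈ 1#) (≡.sym n≡2m) (sign-double m))) (*-identityˡ _))) ⟩
      negVar C                   ≋R.≈⟨ negVar-cong C≋E[X²] ⟩
      negVar (subSq E)           ≋R.≈⟨ negVar-subSq E ⟩
      subSq E                    ≋R.≈⟨ Pₚ.sym C≋E[X²] ⟩
      C                          ≋R.∎
    A≈E*E : A ≈ₚ E *ₚ E
    A≈E*E = un≋ (subSq-injective (≋R.begin
      subSq A                    ≋R.≈⟨ Pₚ.sym C*C⁻≋subSq-A ⟩
      C *ₚ C⁻                    ≋R.≈⟨ *ₚ-congˡ C C⁻≋C ⟩
      C *ₚ C                     ≋R.≈⟨ *ₚ-cong C≋E[X²] C≋E[X²] ⟩
      subSq E *ₚ subSq E         ≋R.≈⟨ Pₚ.sym (subSq-*ₚ E E) ⟩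
      subSq (E *ₚ E)             ≋R.∎))
    1≤m : 1 ≤ m
    1≤m = ℕP.n≢0⇒n>0 (λ m≡0 → ℕP.<⇒≢ 1≤n (≡.sym (≡.trans n≡2m (≡.cong double m≡0))))
    E-nonconstant : ¬ IsConstant E
    E-nonconstant E-const = 1≉0 (trans (sym cₙ≈1) (≡.subst (λ i → c i ≈ 0#) (≡.sym n≡2m)
      (trans (sym (coeff-evenPart C m)) (E-const m 1≤m))))

  oddCoefficient? : Dec OddCoefficient
  oddCoefficient? = map′ from to (FinP.any? (λ (i : Fin (suc n)) → (Fin.toℕ i % 2 ℕ.≟ 1) ×-dec ¬? (c (Fin.toℕ i) ≈? 0#)))
    where
    from : ∃ (λ (i : Fin (suc n)) → Fin.toℕ i % 2 ≡ 1 × ¬ c (Fin.toℕ i) ≈ 0#) → OddCoefficient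
    from (i , i-odd , cᵢ≉0) = Fin.toℕ i , i-odd , odd⇒1≤ (Fin.toℕ i) i-odd , FinP.toℕ≤pred[n] i , cᵢ≉0
      where
      odd⇒1≤ : ∀ i → i % 2 ≡ 1 → 1 ≤ i
      odd⇒1≤ (suc i) _ = s≤s z≤n
    to : OddCoefficient → ∃ (λ (i : Fin (suc n)) → Fin.toℕ i % 2 ≡ 1 × ¬ c (Fin.toℕ i) ≈ 0#)
    to (i , i-odd , _ , i≤n , cᵢ≉0) =
      Fin.fromℕ< (s≤s i≤n) , ≡.subst (λ k → k % 2 ≡ 1 × ¬ c k ≈ 0#) (≡.sym (FinP.toℕ-fromℕ< (s≤s i≤n))) (i-odd , cᵢ≉0)

  irreducible-A⇒oddCoefficient : Irreducible A → OddCoefficient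
  irreducible-A⇒oddCoefficient A-irr = decidable-stable oddCoefficient? λ ¬odd →
    oddCoefficients≈0⇒reducible-A (oddCoefficient≈0 ¬odd) A-irr
    where
    oddCoefficient≈0 : ¬ OddCoefficient → ∀ j → c (suc (double j)) ≈ 0#
    oddCoefficient≈0 ¬odd j with suc (double j) ℕ.≤? n | c (suc (double j)) ≈? 0#
    ... | _       | yes cᵢ≈0 = cᵢ≈0
    ... | yes i≤n | no cᵢ≉0  = ⊥-elim (¬odd (suc (double j) , suc-double%2≡1 j , s≤s z≤n , i≤n , cᵢ≉0))
    ... | no i≰n  | no _     = C-bounded _ (ℕP.≰⇒> i≰n)

module HalfOrder where
  private
    gcd[2,e]-nonZero : ∀ e → NonZero (gcd 2 e)
    gcd[2,e]-nonZero e = ℕ.≢-nonZero (λ gcd≡0 → ℕP.1+n≢0 (gcd[m,n]≡0⇒m≡0 {2} {e} gcd≡0))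

  divGcd2*gcd≡ : ∀ e → divGcd2 e ℕ.* gcd 2 e ≡ e
  divGcd2*gcd≡ e = ℕD.m/n*n≡m {{gcd[2,e]-nonZero e}} (gcd[m,n]∣n 2 e)

  gcd[2,e]≡1⊎2 : ∀ e → gcd 2 e ≡ 1 ⊎ gcd 2 e ≡ 2
  gcd[2,e]≡1⊎2 e with gcd 2 e | ℕDiv.∣⇒≤ (gcd[m,n]∣m 2 e) | gcd[2,e]-nonZero e
  ... | suc zero          | _                | _ = inj₁ ≡.refl
  ... | suc (suc zero)    | _                | _ = inj₂ ≡.refl
  ... | suc (suc (suc _)) | s≤s (s≤s ())     | _

  divGcd2-positive : ∀ e → 1 ≤ e → 1 ≤ divGcd2 e
  divGcd2-positive e 1≤e with divGcd2 e | divGcd2*gcd≡ e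
  ... | zero  | 0≡e = ⊥-elim (ℕP.<⇒≢ 1≤e 0≡e)
  ... | suc _ | _   = s≤s z≤n

  ∣2*divGcd2 : ∀ e → e ∣ 2 ℕ.* divGcd2 e
  ∣2*divGcd2 e with gcd[2,e]≡1⊎2 e
  ... | inj₁ gcd≡1 = ≡.subst (λ x → x ∣ 2 ℕ.* divGcd2 e)
      (≡.trans (≡.sym (ℕP.*-identityʳ (divGcd2 e))) (≡.trans (≡.cong (divGcd2 e ℕ.*_) (≡.sym gcd≡1)) (divGcd2*gcd≡ e)))
      (ℕDiv.n∣m*n 2)
  ... | inj₂ gcd≡2 = ℕDiv.∣-reflexive (≡.trans (≡.sym (divGcd2*gcd≡ e)) (≡.trans (≡.cong (divGcd2 e ℕ.*_) gcd≡2) (ℕP.*-comm (divGcd2 e) 2)))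

  ∣2*⇒divGcd2∣ : ∀ e m → e ∣ 2 ℕ.* m → divGcd2 e ∣ m
  ∣2*⇒divGcd2∣ e m e∣2m with gcd[2,e]≡1⊎2 e
  ... | inj₁ gcd≡1 = ≡.subst (_∣ m) (≡.trans (≡.sym (divGcd2*gcd≡ e)) (≡.trans (≡.cong (divGcd2 e ℕ.*_) gcd≡1) (ℕP.*-identityʳ (divGcd2 e))))
      (coprime-divisor (gcd≡1⇒coprime (≡.trans (gcd-comm e 2) gcd≡1)) e∣2m)
  ... | inj₂ gcd≡2 = ℕDiv.*-cancelˡ-∣ 2 (≡.subst (_∣ 2 ℕ.* m)
      (≡.trans (≡.sym (divGcd2*gcd≡ e)) (≡.trans (≡.cong (divGcd2 e ℕ.*_) gcd≡2) (ℕP.*-comm (divGcd2 e) 2))) e∣2m)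

module Powers {r : ℕ} (E : FiniteField r) where
  open Field E

  power-+ : ∀ x a b → power E x (a ℕ.+ b) ≈ power E x a * power E x b
  power-+ x zero    b = sym (*-identityˡ _)
  power-+ x (suc a) b = trans (*-congˡ (power-+ x a b)) (sym (*-assoc _ _ _))

  power≈1⇒power-*≈1 : ∀ x e t → power E x e ≈ 1# → power E x (t ℕ.* e) ≈ 1#
  power≈1⇒power-*≈1 x e zero    _       = refl
  power≈1⇒power-*≈1 x e (suc t) xᵉ≈1 =
    trans (power-+ x e (t ℕ.* e)) (trans (*-cong xᵉ≈1 (power≈1⇒power-*≈1 x e t xᵉ≈1)) (*-identityˡ _))

  power-square : ∀ x m → power E (x * x) m ≈ power E x (2 ℕ.* m)
  power-square x zero    = refl
  power-square x (suc m) = begin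
      (x * x) * power E (x * x) m        ≈⟨ *-congˡ (power-square x m) ⟩
      (x * x) * power E x (2 ℕ.* m)      ≈⟨ *-assoc _ _ _ ⟩
      x * (x * power E x (2 ℕ.* m))      ≡⟨ ≡.cong (power E x) (≡.sym (ℕP.*-distribˡ-+ 2 1 m)) ⟩
      power E x (2 ℕ.* suc m)            ∎

  order∣ : ∀ {x e} → IsOrder E x e → ∀ k → power E x k ≈ 1# → e ∣ k
  order∣ {x} {e} (1≤e , xᵉ≈1 , e-least) k xᵏ≈1 = ℕDiv.m%n≡0⇒n∣m k e k%e≡0
    where
    instance
      e-nonZero : NonZero e
      e-nonZero = ℕ.>-nonZero 1≤e
    x^[k%e]≈1 : power E x (k % e) ≈ 1#
    x^[k%e]≈1 = begin
      power E x (k % e)                                  ≈⟨ sym (*-identityʳ _) ⟩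
      power E x (k % e) * 1#                             ≈⟨ *-congˡ (sym (power≈1⇒power-*≈1 x e (k / e) xᵉ≈1)) ⟩
      power E x (k % e) * power E x ((k / e) ℕ.* e)      ≈⟨ sym (power-+ x (k % e) ((k / e) ℕ.* e)) ⟩
      power E x (k % e ℕ.+ (k / e) ℕ.* e)                ≡⟨ ≡.cong (power E x) (≡.sym (ℕD.m≡m%n+[m/n]*n k e)) ⟩
      power E x k                                        ≈⟨ xᵏ≈1 ⟩
      1#                                                 ∎
    k%e≡0 : k % e ≡ 0
    k%e≡0 with k % e | ℕD.m%n<n k e | x^[k%e]≈1
    ... | zero  | _     | _        = ≡.refl
    ... | suc j | j<e   | x^[1+j]≈1 = ⊥-elim (ℕP.<⇒≱ j<e (e-least (suc j) (s≤s z≤n) x^[1+j]≈1))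

  ∣⇒power≈1 : ∀ {x e} → IsOrder E x e → ∀ k → e ∣ k → power E x k ≈ 1#
  ∣⇒power≈1 {x} {e} (_ , xᵉ≈1 , _) k (divides t ≡.refl) = power≈1⇒power-*≈1 x e t xᵉ≈1

module Evaluation {q r : ℕ} (F : FiniteField q) (E : FiniteField r) (ι : RingHom F E) where
  open Division F public
  open Ext F E ι using (eval)
  module E where
    open Field E public
    open Powers E public
  open RingHom ι

  ι-0# : ⟦ 0# ⟧ E.≈ E.0#
  ι-0# = E.x+x≈x⇒x≈0 ⟦ 0# ⟧ (E.trans (E.sym (+-hom 0# 0#)) (cong (+-identityˡ 0#)))

  ι-neg : ∀ x → ⟦ - x ⟧ E.≈ E.- ⟦ x ⟧
  ι-neg x = E.+-inverseˡ-unique ⟦ - x ⟧ ⟦ x ⟧ (E.trans (E.sym (+-hom (- x) x)) (E.trans (cong (-‿inverseˡ x)) ι-0#))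

  eval-≈[] : ∀ p x → p ≈ₚ [] → eval p x E.≈ E.0#
  eval-≈[] []      x _   = E.refl
  eval-≈[] (a ∷ p) x a∷p≈0 = E.trans (E.+-cong (E.trans (cong (a∷p≈0 0)) ι-0#) (E.*-congˡ (eval-≈[] p x (λ i → a∷p≈0 (suc i)))))
                                     (E.trans (E.+-identityˡ _) (E.zeroʳ x))

  eval-cong : ∀ {p p'} x → p ≋ p' → eval p x E.≈ eval p' x
  eval-cong {[]}    {p'}     x (mk≋ p≈p') = E.sym (eval-≈[] p' x (λ i → sym (p≈p' i)))
  eval-cong {a ∷ p} {[]}     x (mk≋ p≈p') = eval-≈[] (a ∷ p) x p≈p'
  eval-cong {a ∷ p} {b ∷ p'} x (mk≋ p≈p') = E.+-cong (cong (p≈p' 0)) (E.*-congˡ (eval-cong {p} {p'} x (mk≋ (λ i → p≈p' (suc i)))))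

  eval-+ₚ : ∀ p p' x → eval (p +ₚ p') x E.≈ eval p x E.+ eval p' x
  eval-+ₚ []      p'       x = E.sym (E.+-identityˡ _)
  eval-+ₚ (a ∷ p) []       x = E.sym (E.+-identityʳ _)
  eval-+ₚ (a ∷ p) (b ∷ p') x = E.trans (E.+-cong (+-hom a b) (E.trans (E.*-congˡ (eval-+ₚ p p' x)) (E.distribˡ x _ _)))
     (E.solve 4 (λ a b c d → (a E.:+ b) E.:+ (c E.:+ d) E.:= (a E.:+ c) E.:+ (b E.:+ d)) E.refl ⟦ a ⟧ ⟦ b ⟧ (x E.* eval p x) (x E.* eval p' x))

  eval-scale : ∀ c p x → eval (scale c p) x E.≈ ⟦ c ⟧ E.* eval p x
  eval-scale c []      x = E.sym (E.zeroʳ _)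
  eval-scale c (a ∷ p) x = E.trans (E.+-cong (*-hom c a) (E.*-congˡ (eval-scale c p x)))
     (E.solve 4 (λ c a x p → c E.:* a E.:+ x E.:* (c E.:* p) E.:= c E.:* (a E.:+ x E.:* p)) E.refl ⟦ c ⟧ ⟦ a ⟧ x (eval p x))

  eval-*ₚ : ∀ p p' x → eval (p *ₚ p') x E.≈ eval p x E.* eval p' x
  eval-*ₚ []      p' x = E.sym (E.zeroˡ _)
  eval-*ₚ (a ∷ p) p' x = E.begin
      eval (scale a p' +ₚ (0# ∷ p *ₚ p')) x                   E.≈⟨ eval-+ₚ (scale a p') (0# ∷ p *ₚ p') x ⟩
      eval (scale a p') x E.+ (⟦ 0# ⟧ E.+ x E.* eval (p *ₚ p') x)
        E.≈⟨ E.+-cong (eval-scale a p' x) (E.+-cong ι-0# (E.*-congˡ (eval-*ₚ p p' x))) ⟩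
      ⟦ a ⟧ E.* eval p' x E.+ (E.0# E.+ x E.* (eval p x E.* eval p' x))
        E.≈⟨ E.solve 4 (λ a q x p → a E.:* q E.:+ (E.con 0 E.:+ x E.:* (p E.:* q)) E.:= (a E.:+ x E.:* p) E.:* q) E.refl ⟦ a ⟧ (eval p' x) x (eval p x) ⟩
      (⟦ a ⟧ E.+ x E.* eval p x) E.* eval p' x                E.∎

  eval-subSq : ∀ p x → eval (subSq p) x E.≈ eval p (x E.* x)
  eval-subSq []      x = E.refl
  eval-subSq (a ∷ p) x = E.+-congˡ (E.trans (E.*-congˡ (E.+-cong ι-0# (E.*-congˡ (eval-subSq p x))))
     (E.solve 2 (λ x p → x E.:* (E.con 0 E.:+ x E.:* p) E.:= x E.:* x E.:* p) E.refl x (eval p (x E.* x))))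

  eval-1ₚ : ∀ x → eval 1ₚ x E.≈ E.1#
  eval-1ₚ x = E.trans (E.+-cong 1-hom (E.zeroʳ x)) (E.+-identityʳ _)

  Xᵐ : ℕ → Pol
  Xᵐ zero    = 1ₚ
  Xᵐ (suc m) = 0# ∷ Xᵐ m

  Xᵐ-1 : ℕ → Pol
  Xᵐ-1 m = Xᵐ m +ₚ const (- 1#)

  eval-Xᵐ-1 : ∀ m x → eval (Xᵐ-1 m) x E.≈ power E x m E.+ E.- E.1#
  eval-Xᵐ-1 m x = E.trans (eval-+ₚ (Xᵐ m) (const (- 1#)) x) (E.+-cong (eval-Xᵐ m)
      (E.trans (E.+-cong (ι-neg 1#) (E.zeroʳ x)) (E.trans (E.+-identityʳ _) (E.-‿cong 1-hom))))
    where
    eval-Xᵐ : ∀ m → eval (Xᵐ m) x E.≈ power E x m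
    eval-Xᵐ zero    = eval-1ₚ x
    eval-Xᵐ (suc m) = E.trans (E.+-cong ι-0# (E.*-congˡ (eval-Xᵐ m))) (E.+-identityˡ _)

  root-Xᵐ-1⇔power≈1 : ∀ m x → (eval (Xᵐ-1 m) x E.≈ E.0# → power E x m E.≈ E.1#) × (power E x m E.≈ E.1# → eval (Xᵐ-1 m) x E.≈ E.0#)
  root-Xᵐ-1⇔power≈1 m x = (λ root → E.x∙y⁻¹≈ε⇒x≈y _ _ (E.trans (E.sym (eval-Xᵐ-1 m x)) root))
                        , (λ xᵐ≈1 → E.trans (eval-Xᵐ-1 m x) (E.trans (E.+-congʳ xᵐ≈1) (E.-‿inverseʳ E.1#)))

  -- P and h cannot be coprime, since 1 = uP + vh would vanish at α.
  irreducible∧commonRoot⇒∣ : ∀ P → Irreducible P → ∀ α h → eval P α E.≈ E.0# → eval h α E.≈ E.0# → P ∣ₚ h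
  irreducible∧commonRoot⇒∣ P P-irr α h P[α]≈0 h[α]≈0 with irreducible⇒∣⊎coprime P P-irr h
  ... | inj₁ P∣h = P∣h
  ... | inj₂ (u , v , 1≋uP+vh) = ⊥-elim (E.1≉0 (E.begin
      E.1#                                          E.≈⟨ E.sym (eval-1ₚ α) ⟩
      eval 1ₚ α                                     E.≈⟨ eval-cong α 1≋uP+vh ⟩
      eval (u *ₚ P +ₚ v *ₚ h) α                     E.≈⟨ eval-+ₚ (u *ₚ P) (v *ₚ h) α ⟩
      eval (u *ₚ P) α E.+ eval (v *ₚ h) α           E.≈⟨ E.+-cong (eval-*ₚ u P α) (eval-*ₚ v h α) ⟩
      eval u α E.* eval P α E.+ eval v α E.* eval h α E.≈⟨ E.+-cong (E.*-congˡ P[α]≈0) (E.*-congˡ h[α]≈0) ⟩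
      eval u α E.* E.0# E.+ eval v α E.* E.0#       E.≈⟨ E.trans (E.+-cong (E.zeroʳ _) (E.zeroʳ _)) (E.+-identityˡ _) ⟩
      E.0#                                          E.∎))

  ∣∧root⇒root : ∀ P h α → P ∣ₚ h → eval P α E.≈ E.0# → eval h α E.≈ E.0#
  ∣∧root⇒root P h α (K , h≋PK) P[α]≈0 =
    E.trans (eval-cong α h≋PK) (E.trans (eval-*ₚ P K α) (E.trans (E.*-congʳ P[α]≈0) (E.zeroˡ _)))

module RootSquare {q r : ℕ} (F : FiniteField q) (E : FiniteField r) (ι : RingHom F E)
         (1+1≉0 : CharacteristicNot2 F)
         (C : Poly.Pol F) {n : ℕ} (C-monic : Poly.MonicOfDegree F C n)
         (A-irr : Poly.Irreducible F (Poly.Apoly F C n)) where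
  open Evaluation F E ι
  open Ext F E ι using (eval; IsMinimalPolynomial)
  open ProductWithReflection F 1+1≉0 C C-monic using (A; C⁻; C*C⁻≋subSq-A; A-monic; HasDegree-A)
  open HalfOrder

  root⇒square-root-A : ∀ β → eval C β E.≈ E.0# → eval A (β E.* β) E.≈ E.0#
  root⇒square-root-A β C[β]≈0 = E.begin
      eval A (β E.* β)             E.≈⟨ E.sym (eval-subSq A β) ⟩
      eval (subSq A) β             E.≈⟨ eval-cong β (Pₚ.sym C*C⁻≋subSq-A) ⟩
      eval (C *ₚ C⁻) β             E.≈⟨ eval-*ₚ C C⁻ β ⟩
      eval C β E.* eval C⁻ β       E.≈⟨ E.trans (E.*-congʳ C[β]≈0) (E.zeroˡ _) ⟩
      E.0#                         E.∎

  root⇒minimalPolynomial : ∀ α → eval A α E.≈ E.0# → IsMinimalPolynomial α A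
  root⇒minimalPolynomial α A[α]≈0 = n , A-monic , A[α]≈0 , minimal
    where
    minimal : ∀ f → ¬ f ≈ₚ [] → eval f α E.≈ E.0# → ∀ e → HasDegree f e → n ≤ e
    minimal f f≉0 f[α]≈0 e f°e with irreducible∧commonRoot⇒∣ A A-irr α f A[α]≈0 f[α]≈0
    ... | K , f≋AK = ≡.subst (n ≤_) (HasDegree-unique f (HasDegree-cong (Pₚ.sym f≋AK) (HasDegree-*ₚ A K HasDegree-A (proj₂ (degree K K≉0)))) f°e)
                             (ℕP.m≤m+n n _)
      where
      K≉0 : ¬ K ≈ₚ []
      K≉0 K≈0 = f≉0 (λ i → trans (un≋ f≋AK i) (*ₚ-zeroʳ A K K≈0 i))

  -- Both are roots of the irreducible A, so A ∣ Xᵐ - 1 whenever one of them is.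
  roots-power≈1 : ∀ x y → eval A x E.≈ E.0# → eval A y E.≈ E.0# → ∀ m → power E x m E.≈ E.1# → power E y m E.≈ E.1#
  roots-power≈1 x y A[x]≈0 A[y]≈0 m xᵐ≈1 = proj₁ (root-Xᵐ-1⇔power≈1 m y)
    (∣∧root⇒root A (Xᵐ-1 m) y (irreducible∧commonRoot⇒∣ A A-irr x (Xᵐ-1 m) A[x]≈0 (proj₂ (root-Xᵐ-1⇔power≈1 m x) xᵐ≈1)) A[y]≈0)

  -- γᵐ = 1 ⇔ (β²)ᵐ = 1 ⇔ e ∣ 2m, and the least such m ≥ 1 is e / gcd(2, e).
  root-order : ∀ β → eval C β E.≈ E.0# → ∀ e → IsOrder E β e → ∀ γ → eval A γ E.≈ E.0# → IsOrder E γ (divGcd2 e)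
  root-order β C[β]≈0 e β-order γ A[γ]≈0 = divGcd2-positive e (proj₁ β-order) , γ^d≈1 , d-least
    where
    β² : E.Carrier
    β² = β E.* β
    A[β²]≈0 : eval A β² E.≈ E.0#
    A[β²]≈0 = root⇒square-root-A β C[β]≈0
    γ^d≈1 : power E γ (divGcd2 e) E.≈ E.1#
    γ^d≈1 = roots-power≈1 β² γ A[β²]≈0 A[γ]≈0 (divGcd2 e)
      (E.trans (E.power-square β (divGcd2 e)) (E.∣⇒power≈1 β-order _ (∣2*divGcd2 e)))
    d-least : ∀ m → 1 ≤ m → power E γ m E.≈ E.1# → divGcd2 e ≤ m
    d-least (suc m) _ γᵐ≈1 = ℕDiv.∣⇒≤ (∣2*⇒divGcd2∣ e (suc m)
      (E.order∣ β-order _ (E.trans (E.sym (E.power-square β (suc m))) (roots-power≈1 γ β² A[γ]≈0 A[β²]≈0 (suc m) γᵐ≈1))))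

corollary3 : (q : ℕ) → OddPrimePower q → (F : FiniteField q) → (n : ℕ) → 1 ≤ n →
    let open Poly F in
    (C : Pol) → MonicOfDegree C n → Irreducible C →
    ((C *ₚ scale (sign n) (negVar C)) ≈ₚ subSq (Apoly C n))
    × HasDegree (Apoly C n) n
    × (Irreducible (Apoly C n) ⇔ (∃ λ i → i % 2 ≡ 1 × 1 ≤ i × i ≤ n × ¬ (FiniteField._≈_ F (coeff C i) (FiniteField.0# F))))
    × (Irreducible (Apoly C n) → ¬ (Apoly C n ≈ₚ Xₚ) →
    (E : FiniteField (q ^ n)) (ι : RingHom F E) (β : FiniteField.Carrier E) →
    FiniteField._≈_ E (Ext.eval F E ι C β) (FiniteField.0# E) →
    Ext.IsMinimalPolynomial F E ι (FiniteField._*_ E β β) (Apoly C n)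
    × ((e : ℕ) → IsOrder E β e → (γ : FiniteField.Carrier E) →
    FiniteField._≈_ E (Ext.eval F E ι (Apoly C n) γ) (FiniteField.0# E) →
    IsOrder E γ (divGcd2 e)))
corollary3 q (_ , q-odd) F n 1≤n C C-monic C-irr =
    C*C⁻≈subSq-A , HasDegree-A ,
    mk⇔ irreducible-A⇒oddCoefficient oddCoefficient⇒irreducible-A ,
    λ A-irr _ E ι β C[β]≈0 → let open RootSquare F E ι 1+1≉0 C C-monic A-irr in
      root⇒minimalPolynomial _ (root⇒square-root-A β C[β]≈0) , λ e β-order → root-order β C[β]≈0 e β-order
  where
  1+1≉0 : CharacteristicNot2 F
  1+1≉0 = odd-cardinality⇒characteristicNot2 F q-odd
  open IrreducibilityCriterion F 1+1≉0 C C-monic 1≤n C-irr
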